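{- Let $G$ be a finite-dimensional $\mathbb{F}_p$-vector space and $V\subseteq G$ a $(c_0,\delta,\varepsilon)$-approximate quadratic variety. For all but at most $20\sqrt{\varepsilon} |G|^4$ quadruples $(a,d_1,d_2, d_3) \in G^4$ we have \[\mathbb{E}_{x\in G}1_V(x)1_V(x+a)1_V(x+d_1)1_V(x+d_1+a)1_V(x+d_1 -d_2)1_V(x+d_1-d_2 + a)1_V(x+d_3)1_V(x+d_3+a) \leq \delta^5 + \varepsilon^{1/4}.\]
   Context: $\partial_a f(x)=f(x+a)\overline{f(x)}$; $\|f\|_{\mathsf{U}^2}=(\mathbb{E}_{x,a,b}\partial_a\partial_bf(x))^{1/4}$. $V\subseteq G$ is a $(c_0,\delta,\varepsilon)$-approximate quadratic variety if $|V|=\delta|G|$, $\|1_V-\delta\|_{\mathsf{U}^2}\le\varepsilon$ and $\mathbb{E}_{x,a,b,c}\partial_a\partial_b\partial_c1_V(x)=c_0\delta^7$.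
   Formalization: The parameters $c_0$ and $\varepsilon$ of the approximate quadratic variety are taken in ℚ. -}

module Defs where

open import Data.Nat as ℕ using (ℕ; zero; suc; NonZero)
open import Data.Nat.DivMod using (_mod_)
open import Data.Fin using (Fin; toℕ)
open import Data.Vec using (Vec; []; _∷_; zipWith)
open import Data.List using (List; []; _∷_; map; concatMap; allFin; foldr; length)
open import Data.Integer using (+_)
open import Data.Rational using (ℚ; 0ℚ; 1ℚ; _+_; _*_; _-_; _≤_; _/_)
open import Data.Bool using (Bool; true; false; if_then_else_)
open import Data.Sum using (_⊎_)
open import Relation.Binary.PropositionalEquality using (_≡_)
open import Data.Product using (_×_; _,_)
open import Relation.Nullary using (¬_; Dec; ¬?)
open import Relation.Nullary.Decidable using (_⊎-dec_)
open import Data.Rational.Properties using (_≤?_)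
open import Data.List using (filter)

-- The group G = 𝔽_p^n  (every n-dim 𝔽_p-vector space is isomorphic to it)

module Field (p : ℕ) .{{_ : NonZero p}} where

  _+ₚ_ : Fin p → Fin p → Fin p
  a +ₚ b = (toℕ a ℕ.+ toℕ b) mod p

  -ₚ_ : Fin p → Fin p
  -ₚ a = (p ℕ.∸ toℕ a) mod p

  G : ℕ → Set
  G n = Vec (Fin p) n

  _⊕_ : ∀ {n} → G n → G n → G n
  _⊕_ = zipWith _+ₚ_

  ⊖_ : ∀ {n} → G n → G n
  ⊖ x = Data.Vec.map -ₚ_ x

  _⊝_ : ∀ {n} → G n → G n → G n
  x ⊝ y = x ⊕ (⊖ y)

  elems : (n : ℕ) → List (G n)
  elems zero = [] ∷ []
  elems (suc n) = concatMap (λ a → map (a ∷_) (elems n)) (allFin p)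

ℕtoℚ : ℕ → ℚ
ℕtoℚ n = (+ n) / 1

-- 1/n  (with 1/0 := 0; only used for n = |G| ≥ 1)
inv : ℕ → ℚ
inv zero = 0ℚ
inv (suc k) = (+ 1) / suc k

_^_ : ℚ → ℕ → ℚ
x ^ zero = 1ℚ
x ^ suc k = x * (x ^ k)

sumℚ : List ℚ → ℚ
sumℚ = foldr _+_ 0ℚ

𝔼 : ∀ {A : Set} → List A → (A → ℚ) → ℚ
𝔼 xs f = sumℚ (map f xs) * inv (length xs)

𝟙 : ∀ {A : Set} → (A → Bool) → A → ℚ
𝟙 V x = if V x then 1ℚ else 0ℚ

-- "x ≤ c · y^(1/k)"  for  c ≥ 0, y ≥ 0, k ≥ 1 :
-- since t ↦ t^k is strictly increasing on [0,∞), this holds iff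
-- x ≤ 0 or x^k ≤ c^k · y.
LeScaledRoot : ℕ → ℚ → ℚ → ℚ → Set
LeScaledRoot k c y x = (x ≤ 0ℚ) ⊎ ((x ^ k) ≤ ((c ^ k) * y))

LeScaledRoot? : ∀ k c y x → Dec (LeScaledRoot k c y x)
LeScaledRoot? k c y x = (x ≤? 0ℚ) ⊎-dec ((x ^ k) ≤? ((c ^ k) * y))

-- Gowers-type quantities on G = 𝔽_p^n, for ℚ-valued functions
-- (functions here are real-valued, so complex conjugation is the identity)

module Gowers (p : ℕ) .{{_ : NonZero p}} (n : ℕ) where
  open Field p

  ∂ : G n → (G n → ℚ) → G n → ℚ
  ∂ a f x = f (x ⊕ a) * f x

  U2⁴ : (G n → ℚ) → ℚ
  U2⁴ f = 𝔼 (elems n) λ x → 𝔼 (elems n) λ a → 𝔼 (elems n) λ b → ∂ a (∂ b f) x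

  U3⁸ : (G n → ℚ) → ℚ
  U3⁸ f = 𝔼 (elems n) λ x → 𝔼 (elems n) λ a → 𝔼 (elems n) λ b → 𝔼 (elems n) λ c →
            ∂ a (∂ b (∂ c f)) x

  ∣G∣ : ℚ
  ∣G∣ = ℕtoℚ (length (elems n))

  -- (c₀, δ, ε)-approximate quadratic variety.
  -- ‖1_V − δ‖_{U²} ≤ ε is written out as  0 ≤ ε  and  ‖1_V − δ‖_{U²}^4 ≤ ε^4
  -- (the U² norm is the nonnegative 4th root of U2⁴, which is ≥ 0).
  record ApproxQuadVariety (c₀ δ ε : ℚ) (V : G n → Bool) : Set where
    field
      size    : sumℚ (map (𝟙 V) (elems n)) ≡ δ * ∣G∣
      ε≥0     : 0ℚ ≤ ε
      unif    : U2⁴ (λ x → 𝟙 V x - δ) ≤ (ε ^ 4)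
      cubic   : U3⁸ (𝟙 V) ≡ c₀ * (δ ^ 7)

  Λ : (G n → Bool) → G n → G n → G n → G n → ℚ
  Λ V a d₁ d₂ d₃ = 𝔼 (elems n) λ x →
      𝟙 V x * 𝟙 V (x ⊕ a)
    * 𝟙 V (x ⊕ d₁) * 𝟙 V ((x ⊕ d₁) ⊕ a)
    * 𝟙 V ((x ⊕ d₁) ⊝ d₂) * 𝟙 V (((x ⊕ d₁) ⊝ d₂) ⊕ a)
    * 𝟙 V (x ⊕ d₃) * 𝟙 V ((x ⊕ d₃) ⊕ a)

  quads : List (G n × G n × G n × G n)
  quads = concatMap (λ a → concatMap (λ d₁ → concatMap (λ d₂ → map (λ d₃ → a , d₁ , d₂ , d₃)
            (elems n)) (elems n)) (elems n)) (elems n)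

  -- the inequality  Λ ≤ δ⁵ + ε^{1/4}  for a quadruple
  Good : (V : G n → Bool) (δ ε : ℚ) → G n × G n × G n × G n → Set
  Good V δ ε (a , d₁ , d₂ , d₃) = LeScaledRoot 4 1ℚ ε (Λ V a d₁ d₂ d₃ - (δ ^ 5))

  Good? : ∀ V δ ε q → Dec (Good V δ ε q)
  Good? V δ ε (a , d₁ , d₂ , d₃) = LeScaledRoot? 4 1ℚ ε (Λ V a d₁ d₂ d₃ - (δ ^ 5))

  #bad : (V : G n → Bool) (δ ε : ℚ) → ℕ
  #bad V δ ε = length (filter (λ q → ¬? (Good? V δ ε q)) quads)

-- Write 1_V = δ + f, so that ‖f‖_{U²} ≤ ε. Discarding the factors 1_V(· + a) of the last three
-- pairs bounds the average Λ(a, d₁, d₂, d₃) by 𝔼ₓ P(x) 1_V(x + d₃), where P is a product of four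
-- translates of 1_V; splitting off one factor 1_V = δ + f at a time gives
--   Λ − δ⁵ ≤ |u₁| + |u₂| + |u₃| + |u₄|,  uᵢ = 𝔼ₓ Aᵢ(x) f(x + dᵢ) with 0 ≤ Aᵢ ≤ 1,
-- where dᵢ runs through a, d₁, d₁ − d₂, d₃. By Cauchy–Schwarz, 𝔼_d (𝔼ₓ A(x) f(x + d))² ≤ ‖f‖²_{U²} ≤ ε²
-- for every such A, so by Chebyshev at most 16 ε^(3/2) |G| values of dᵢ make |uᵢ| > ε^(1/4)/4.
-- If no uᵢ is that large then Λ − δ⁵ ≤ ε^(1/4), so there are at most 64 ε^(3/2) |G|⁴ bad
-- quadruples; this is below 20 √ε |G|⁴ for ε ≤ 1/4, and |G|⁴ is below it otherwise.
-- Inequalities are squared throughout so that no roots of rationals are needed.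

module Submission where

open import Defs
open import Data.Nat using (ℕ; NonZero)
open import Data.Nat.Primality using (Prime)
open import Data.Rational using (ℚ; _*_; 0ℚ; _≤_)
open import Data.Bool using (Bool)

module RationalLemmas where

  open import Data.Nat as ℕ using (zero; suc)
  import Data.Integer as ℤ
  open import Data.Nat.Coprimality as Coprime using ()
  open import Data.Product using (∃-syntax; _×_; _,_; proj₂)
  open import Data.Rational
  open import Data.Rational.Properties
  open import Data.Rational.Solver
  open import Data.Sum using (inj₁; inj₂)
  open import Relation.Binary.PropositionalEquality
  open import Relation.Nullary using (yes; no; contradiction)
  open +-*-Solver

  *-nonNeg : ∀ {p q} → 0ℚ ≤ p → 0ℚ ≤ q → 0ℚ ≤ p * q
  *-nonNeg {p} {q} 0≤p 0≤q =
    subst (_≤ p * q) (*-zeroʳ p) (*-monoˡ-≤-nonNeg p {{nonNegative 0≤p}} 0≤q)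

  *-mono-≤-nonNeg : ∀ {p q r s} → 0ℚ ≤ p → 0ℚ ≤ s → p ≤ q → r ≤ s → p * r ≤ q * s
  *-mono-≤-nonNeg {p} {q} {r} {s} 0≤p 0≤s p≤q r≤s = ≤-trans
    (*-monoˡ-≤-nonNeg p {{nonNegative 0≤p}} r≤s)
    (*-monoʳ-≤-nonNeg s {{nonNegative 0≤s}} p≤q)

  ∣p∣*∣p∣≡p*p : ∀ p → ∣ p ∣ * ∣ p ∣ ≡ p * p
  ∣p∣*∣p∣≡p*p p with ∣p∣≡p∨∣p∣≡-p p
  ... | inj₁ ∣p∣≡p  = cong₂ _*_ ∣p∣≡p ∣p∣≡p
  ... | inj₂ ∣p∣≡-p = trans (cong₂ _*_ ∣p∣≡-p ∣p∣≡-p)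
    (solve 1 (λ x → (:- x) :* (:- x) := x :* x) refl p)

  0≤p*p : ∀ p → 0ℚ ≤ p * p
  0≤p*p p = subst (0ℚ ≤_) (∣p∣*∣p∣≡p*p p) (*-nonNeg (0≤∣p∣ p) (0≤∣p∣ p))

  p≤∣p∣ : ∀ p → p ≤ ∣ p ∣
  p≤∣p∣ p with p ≤? 0ℚ
  ... | yes p≤0 = ≤-trans p≤0 (0≤∣p∣ p)
  ... | no p≰0  = ≤-reflexive (sym (0≤p⇒∣p∣≡p (<⇒≤ (≰⇒> p≰0))))

  t*p≤∣p∣ : ∀ {t} p → 0ℚ ≤ t → t ≤ 1ℚ → t * p ≤ ∣ p ∣
  t*p≤∣p∣ {t} p 0≤t t≤1 = begin
    t * p          ≤⟨ p≤∣p∣ (t * p) ⟩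
    ∣ t * p ∣      ≡⟨ ∣p*q∣≡∣p∣*∣q∣ t p ⟩
    ∣ t ∣ * ∣ p ∣  ≡⟨ cong (_* ∣ p ∣) (0≤p⇒∣p∣≡p 0≤t) ⟩
    t * ∣ p ∣      ≤⟨ *-monoʳ-≤-nonNeg ∣ p ∣ {{nonNegative (0≤∣p∣ p)}} t≤1 ⟩
    1ℚ * ∣ p ∣     ≡⟨ *-identityˡ ∣ p ∣ ⟩
    ∣ p ∣          ∎
    where open ≤-Reasoning

  p*q≤p : ∀ {p q} → 0ℚ ≤ p → q ≤ 1ℚ → p * q ≤ p
  p*q≤p {p} 0≤p q≤1 =
    ≤-trans (*-monoˡ-≤-nonNeg p {{nonNegative 0≤p}} q≤1) (≤-reflexive (*-identityʳ p))

  0≤_≤1 : ℚ → Set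
  0≤ p ≤1 = 0ℚ ≤ p × p ≤ 1ℚ

  0≤*≤1 : ∀ {p q} → 0≤ p ≤1 → 0≤ q ≤1 → 0≤ p * q ≤1
  0≤*≤1 (0≤p , p≤1) (0≤q , q≤1) = *-nonNeg 0≤p 0≤q , ≤-trans (p*q≤p 0≤p q≤1) p≤1

  0≤≤1⇒p*p≤1 : ∀ {p} → 0≤ p ≤1 → p * p ≤ 1ℚ
  0≤≤1⇒p*p≤1 p∈ = proj₂ (0≤*≤1 p∈ p∈)

  p*p≤q*q⇒p≤q : ∀ {p q} → 0ℚ ≤ q → p * p ≤ q * q → p ≤ q
  p*p≤q*q⇒p≤q {p} {q} 0≤q p²≤q² with p ≤? q
  ... | yes p≤q = p≤q
  ... | no p≰q  = contradiction (≤-<-trans p²≤q² (begin-strict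
    q * q  ≤⟨ *-monoʳ-≤-nonNeg q {{nonNegative 0≤q}} (<⇒≤ q<p) ⟩
    p * q  <⟨ *-monoʳ-<-pos p {{positive (≤-<-trans 0≤q q<p)}} q<p ⟩
    p * p  ∎)) (<-irrefl refl)
    where
    open ≤-Reasoning
    q<p = ≰⇒> p≰q

  ⊔-closed : ∀ (P : ℚ → Set) {p q} → P p → P q → P (p ⊔ q)
  ⊔-closed P {p} {q} Pp Pq with ⊔-sel p q
  ... | inj₁ p⊔q≡p = subst P (sym p⊔q≡p) Pp
  ... | inj₂ p⊔q≡q = subst P (sym p⊔q≡q) Pq

  sum₄≤4*term : ∀ (P : ℚ → Set) a b c d → P a → P b → P c → P d →
                ∃[ m ] P m × a + b + c + d ≤ ℕtoℚ 4 * m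
  sum₄≤4*term P a b c d Pa Pb Pc Pd =
    m , ⊔-closed P (⊔-closed P (⊔-closed P Pa Pb) Pc) Pd , (begin
      a + b + c + d  ≤⟨ +-mono-≤ (+-mono-≤ (+-mono-≤ a≤m b≤m) c≤m) d≤m ⟩
      m + m + m + m  ≡⟨ solve 1 (λ x → x :+ x :+ x :+ x := con (ℕtoℚ 4) :* x) refl m ⟩
      ℕtoℚ 4 * m     ∎)
    where
    open ≤-Reasoning
    m = a ⊔ b ⊔ c ⊔ d
    a≤m = ≤-trans (p≤p⊔q a b) (≤-trans (p≤p⊔q (a ⊔ b) c) (p≤p⊔q (a ⊔ b ⊔ c) d))
    b≤m = ≤-trans (p≤q⊔p a b) (≤-trans (p≤p⊔q (a ⊔ b) c) (p≤p⊔q (a ⊔ b ⊔ c) d))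
    c≤m = ≤-trans (p≤q⊔p (a ⊔ b) c) (p≤p⊔q (a ⊔ b ⊔ c) d)
    d≤m = p≤q⊔p (a ⊔ b ⊔ c) d

  ℕtoℚ≡mkℚ : ∀ k → ℕtoℚ k ≡ mkℚ (ℤ.+ k) 0 (Coprime.sym (Coprime.1-coprimeTo k))
  ℕtoℚ≡mkℚ k = normalize-coprime (Coprime.sym (Coprime.1-coprimeTo k))

  ℕtoℚ-suc : ∀ k → ℕtoℚ (suc k) ≡ 1ℚ + ℕtoℚ k
  ℕtoℚ-suc k = sym (trans (cong (λ z → 1ℚ + z) (ℕtoℚ≡mkℚ k))
    (cong (_/ 1) (cong (λ z → ℤ.+ 1 ℤ.+ z) (ℤP.*-identityʳ (ℤ.+ k)))))
    where import Data.Integer.Properties as ℤP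

  0≤ℕtoℚ : ∀ k → 0ℚ ≤ ℕtoℚ k
  0≤ℕtoℚ k = nonNegative⁻¹ _ {{normalize-nonNeg k 1}}

  0≤inv : ∀ k → 0ℚ ≤ inv k
  0≤inv zero    = ≤-refl
  0≤inv (suc k) = nonNegative⁻¹ _ {{normalize-nonNeg 1 (suc k)}}

  inv*ℕtoℚ≡1 : ∀ k .{{_ : ℕ.NonZero k}} → inv k * ℕtoℚ k ≡ 1ℚ
  inv*ℕtoℚ≡1 (suc k) = trans (cong₂ _*_ inv≡mkℚ (ℕtoℚ≡mkℚ (suc k)))
    (*-inverseˡ (mkℚ (ℤ.+ suc k) 0 (Coprime.sym (Coprime.1-coprimeTo (suc k)))))
    where
    inv≡mkℚ : inv (suc k) ≡ mkℚ (ℤ.+ 1) k (Coprime.1-coprimeTo (suc k))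
    inv≡mkℚ = normalize-coprime (Coprime.1-coprimeTo (suc k))

  0≤q-p⇒p≤q : ∀ {p q} → 0ℚ ≤ q - p → p ≤ q
  0≤q-p⇒p≤q {p} {q} 0≤q-p = begin
    p            ≡⟨ +-identityʳ p ⟨
    p + 0ℚ       ≤⟨ +-monoʳ-≤ p 0≤q-p ⟩
    p + (q - p)  ≡⟨ solve 2 (λ p q → p :+ (q :- p) := q) refl p q ⟩
    q            ∎
    where open ≤-Reasoning

module ListSums where

  open import Data.Nat as ℕ using (zero; suc)
  open import Data.Bool using (Bool; true; false; if_then_else_)
  open import Data.Product using (_,_)
  open import Data.List using (List; []; _∷_; map; concatMap; length; _++_; filter; tabulate; allFin)
  open import Data.Fin as Fin using (Fin)
  open import Data.Fin.Permutation using (permutation)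
  open import Data.Rational
  open import Data.Rational.Properties
  open import Data.Rational.Solver
  open import Data.Sum using (_⊎_; inj₁; inj₂)
  open import Data.Unit using (tt)
  open import Relation.Binary.PropositionalEquality
  open import Relation.Nullary using (Dec; yes; no; does; contradiction)
  open import Algebra.Properties.CommutativeMonoid.Sum +-0-commutativeMonoid using (sum; sum-permute)
  open RationalLemmas
  open +-*-Solver hiding (⟦_⟧)

  Σ : {A : Set} → List A → (A → ℚ) → ℚ
  Σ xs φ = sumℚ (map φ xs)

  module _ {A : Set} where

    Σ-cong : ∀ (xs : List A) {φ ψ} → (∀ x → φ x ≡ ψ x) → Σ xs φ ≡ Σ xs ψ
    Σ-cong []       φ≡ψ = refl
    Σ-cong (x ∷ xs) φ≡ψ = cong₂ _+_ (φ≡ψ x) (Σ-cong xs φ≡ψ)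

    Σ-mono : ∀ (xs : List A) {φ ψ} → (∀ x → φ x ≤ ψ x) → Σ xs φ ≤ Σ xs ψ
    Σ-mono []       φ≤ψ = ≤-refl
    Σ-mono (x ∷ xs) φ≤ψ = +-mono-≤ (φ≤ψ x) (Σ-mono xs φ≤ψ)

    Σ-nonNeg : ∀ (xs : List A) {φ} → (∀ x → 0ℚ ≤ φ x) → 0ℚ ≤ Σ xs φ
    Σ-nonNeg []       φ≥0 = ≤-refl
    Σ-nonNeg (x ∷ xs) φ≥0 = +-mono-≤ (φ≥0 x) (Σ-nonNeg xs φ≥0)

    Σ-+ : ∀ (xs : List A) φ ψ → Σ xs (λ x → φ x + ψ x) ≡ Σ xs φ + Σ xs ψ
    Σ-+ []       φ ψ = refl
    Σ-+ (x ∷ xs) φ ψ rewrite Σ-+ xs φ ψ =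
      solve 4 (λ a b c d → (a :+ b) :+ (c :+ d) := (a :+ c) :+ (b :+ d)) refl
        (φ x) (ψ x) (Σ xs φ) (Σ xs ψ)

    Σ-*ˡ : ∀ (xs : List A) c φ → Σ xs (λ x → c * φ x) ≡ c * Σ xs φ
    Σ-*ˡ []       c φ = sym (*-zeroʳ c)
    Σ-*ˡ (x ∷ xs) c φ rewrite Σ-*ˡ xs c φ = sym (*-distribˡ-+ c (φ x) (Σ xs φ))

    Σ-*ʳ : ∀ (xs : List A) c φ → Σ xs (λ x → φ x * c) ≡ Σ xs φ * c
    Σ-*ʳ xs c φ = trans (Σ-cong xs (λ x → *-comm (φ x) c)) (trans (Σ-*ˡ xs c φ) (*-comm c _))

    Σ-const : ∀ (xs : List A) c → Σ xs (λ _ → c) ≡ ℕtoℚ (length xs) * c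
    Σ-const []       c = sym (*-zeroˡ c)
    Σ-const (x ∷ xs) c rewrite Σ-const xs c | ℕtoℚ-suc (length xs) =
      solve 2 (λ c k → c :+ k :* c := (con 1ℚ :+ k) :* c) refl c (ℕtoℚ (length xs))

    Σ-++ : ∀ (xs ys : List A) φ → Σ (xs ++ ys) φ ≡ Σ xs φ + Σ ys φ
    Σ-++ []       ys φ = sym (+-identityˡ _)
    Σ-++ (x ∷ xs) ys φ rewrite Σ-++ xs ys φ = sym (+-assoc (φ x) _ _)

  module _ {A B : Set} where

    Σ-map : ∀ (h : A → B) (xs : List A) φ → Σ (map h xs) φ ≡ Σ xs (λ x → φ (h x))
    Σ-map h []       φ = refl
    Σ-map h (x ∷ xs) φ = cong (φ (h x) +_) (Σ-map h xs φ)

    Σ-concatMap : ∀ (g : A → List B) (xs : List A) φ →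
                  Σ (concatMap g xs) φ ≡ Σ xs (λ x → Σ (g x) φ)
    Σ-concatMap g []       φ = refl
    Σ-concatMap g (x ∷ xs) φ =
      trans (Σ-++ (g x) (concatMap g xs) φ) (cong (Σ (g x) φ +_) (Σ-concatMap g xs φ))

    Σ-swap : ∀ (xs : List A) (ys : List B) (φ : A → B → ℚ) →
             Σ xs (λ x → Σ ys (φ x)) ≡ Σ ys (λ y → Σ xs (λ x → φ x y))
    Σ-swap []       ys φ = sym (trans (Σ-const ys 0ℚ) (*-zeroʳ (ℕtoℚ (length ys))))
    Σ-swap (x ∷ xs) ys φ rewrite Σ-swap xs ys φ = sym (Σ-+ ys (φ x) _)

    Σ*Σ : ∀ (xs : List A) (ys : List B) φ ψ →
          Σ xs φ * Σ ys ψ ≡ Σ xs (λ x → Σ ys (λ y → φ x * ψ y))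
    Σ*Σ xs ys φ ψ = sym (trans (Σ-cong xs (λ x → Σ-*ˡ ys (φ x) ψ)) (Σ-*ʳ xs (Σ ys ψ) φ))

  Σ-tabulate : ∀ {A : Set} {m} (f : Fin m → A) (g : A → ℚ) → Σ (tabulate f) g ≡ sum (λ i → g (f i))
  Σ-tabulate {m = zero}  f g = refl
  Σ-tabulate {m = suc m} f g = cong (g (f Fin.zero) +_) (Σ-tabulate (λ i → f (Fin.suc i)) g)

  Σ-allFin-permute : ∀ {m} (h : Fin m → ℚ) (σ τ : Fin m → Fin m) →
                     (∀ i → σ (τ i) ≡ i) → (∀ i → τ (σ i) ≡ i) →
                     Σ (allFin m) (λ i → h (σ i)) ≡ Σ (allFin m) h
  Σ-allFin-permute {m} h σ τ στ τσ = begin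
    Σ (allFin m) (λ i → h (σ i))  ≡⟨ Σ-tabulate (λ i → i) (λ i → h (σ i)) ⟩
    sum (λ i → h (σ i))           ≡⟨ sum-permute h (permutation σ τ στ τσ) ⟨
    sum h                         ≡⟨ Σ-tabulate (λ i → i) h ⟨
    Σ (allFin m) h                ∎
    where open ≡-Reasoning

  0≤𝟙≤1 : ∀ {A : Set} (V : A → Bool) x → 0≤ 𝟙 V x ≤1
  0≤𝟙≤1 V x with V x
  ... | true  = ≤ᵇ⇒≤ tt , ≤-refl
  ... | false = ≤-refl , ≤ᵇ⇒≤ tt

  ⟦_⟧ : ∀ {P : Set} → Dec P → ℚ
  ⟦ P? ⟧ = if does P? then 1ℚ else 0ℚ

  ⟦⟧-nonNeg : ∀ {P : Set} (P? : Dec P) → 0ℚ ≤ ⟦ P? ⟧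
  ⟦⟧-nonNeg (yes _) = ≤ᵇ⇒≤ tt
  ⟦⟧-nonNeg (no _)  = ≤-refl

  ⟦⟧≤1 : ∀ {P : Set} (P? : Dec P) → ⟦ P? ⟧ ≤ 1ℚ
  ⟦⟧≤1 (yes _) = ≤-refl
  ⟦⟧≤1 (no _)  = ≤ᵇ⇒≤ tt

  ⟦⟧-union : ∀ {P Q R : Set} → (P → Q ⊎ R) → (P? : Dec P) (Q? : Dec Q) (R? : Dec R) →
             ⟦ P? ⟧ ≤ ⟦ Q? ⟧ + ⟦ R? ⟧
  ⟦⟧-union P⇒Q⊎R (no _)  Q? R? = +-mono-≤ (⟦⟧-nonNeg Q?) (⟦⟧-nonNeg R?)
  ⟦⟧-union P⇒Q⊎R (yes p) Q? R? with P⇒Q⊎R p | Q? | R?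
  ... | inj₁ q | yes _ | R? = subst (_≤ 1ℚ + ⟦ R? ⟧) (+-identityʳ 1ℚ) (+-monoʳ-≤ 1ℚ (⟦⟧-nonNeg R?))
  ... | inj₁ q | no ¬q | _  = contradiction q ¬q
  ... | inj₂ r | Q? | yes _ = subst (_≤ ⟦ Q? ⟧ + 1ℚ) (+-identityˡ 1ℚ) (+-monoˡ-≤ 1ℚ (⟦⟧-nonNeg Q?))
  ... | inj₂ r | _  | no ¬r = contradiction r ¬r

  module _ {A : Set} {P : A → Set} (P? : ∀ x → Dec (P x)) where

    length-filter≡Σ⟦⟧ : ∀ xs → ℕtoℚ (length (filter P? xs)) ≡ Σ xs (λ x → ⟦ P? x ⟧)
    length-filter≡Σ⟦⟧ []       = refl
    length-filter≡Σ⟦⟧ (x ∷ xs) with P? x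
    ... | yes _ = trans (ℕtoℚ-suc (length (filter P? xs))) (cong (1ℚ +_) (length-filter≡Σ⟦⟧ xs))
    ... | no _  = trans (length-filter≡Σ⟦⟧ xs) (sym (+-identityˡ _))

    Σ⟦⟧≡0 : ∀ xs {φ} → (∀ x → 0ℚ ≤ φ x) → (∀ x → P x → 0ℚ < φ x) → Σ xs φ ≤ 0ℚ →
             Σ xs (λ x → ⟦ P? x ⟧) ≡ 0ℚ
    Σ⟦⟧≡0 []       φ≥0 P⇒φ>0 Σ≤0 = refl
    Σ⟦⟧≡0 (x ∷ xs) {φ} φ≥0 P⇒φ>0 Σ≤0 with P? x
    ... | yes px = contradiction (<-≤-trans (+-mono-<-≤ (P⇒φ>0 x px) (Σ-nonNeg xs φ≥0)) Σ≤0) (<-irrefl refl)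
    ... | no _   = trans (+-identityˡ _) (Σ⟦⟧≡0 xs φ≥0 P⇒φ>0 Σx≤0)
      where
      Σx≤0 : Σ xs φ ≤ 0ℚ
      Σx≤0 = ≤-trans (subst (_≤ φ x + Σ xs φ) (+-identityˡ _) (+-monoˡ-≤ (Σ xs φ) (φ≥0 x))) Σ≤0

  module Expectation {A : Set} (xs : List A) .{{_ : ℕ.NonZero (length xs)}} where

    private
      N I : ℚ
      N = ℕtoℚ (length xs)
      I = inv (length xs)

    𝔼-cong : ∀ {φ ψ} → (∀ x → φ x ≡ ψ x) → 𝔼 xs φ ≡ 𝔼 xs ψ
    𝔼-cong φ≡ψ = cong (_* I) (Σ-cong xs φ≡ψ)

    𝔼-mono : ∀ {φ ψ} → (∀ x → φ x ≤ ψ x) → 𝔼 xs φ ≤ 𝔼 xs ψ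
    𝔼-mono φ≤ψ = *-monoʳ-≤-nonNeg I {{nonNegative (0≤inv (length xs))}} (Σ-mono xs φ≤ψ)

    𝔼-nonNeg : ∀ {φ} → (∀ x → 0ℚ ≤ φ x) → 0ℚ ≤ 𝔼 xs φ
    𝔼-nonNeg φ≥0 = *-nonNeg (Σ-nonNeg xs φ≥0) (0≤inv (length xs))

    𝔼-+ : ∀ φ ψ → 𝔼 xs (λ x → φ x + ψ x) ≡ 𝔼 xs φ + 𝔼 xs ψ
    𝔼-+ φ ψ = trans (cong (_* I) (Σ-+ xs φ ψ)) (*-distribʳ-+ I (Σ xs φ) (Σ xs ψ))

    𝔼-*ˡ : ∀ c φ → 𝔼 xs (λ x → c * φ x) ≡ c * 𝔼 xs φ
    𝔼-*ˡ c φ = trans (cong (_* I) (Σ-*ˡ xs c φ)) (*-assoc c _ I)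

    𝔼-*ʳ : ∀ c φ → 𝔼 xs (λ x → φ x * c) ≡ 𝔼 xs φ * c
    𝔼-*ʳ c φ = trans (𝔼-cong (λ x → *-comm (φ x) c)) (trans (𝔼-*ˡ c φ) (*-comm c _))

    𝔼-const : ∀ c → 𝔼 xs (λ _ → c) ≡ c
    𝔼-const c = begin
      Σ xs (λ _ → c) * I  ≡⟨ cong (_* I) (Σ-const xs c) ⟩
      N * c * I           ≡⟨ solve 3 (λ n c i → n :* c :* i := (i :* n) :* c) refl N c I ⟩
      I * N * c           ≡⟨ cong (_* c) (inv*ℕtoℚ≡1 (length xs)) ⟩
      1ℚ * c              ≡⟨ *-identityˡ c ⟩
      c                   ∎
      where open ≡-Reasoning

    Σ≡|xs|*𝔼 : ∀ φ → Σ xs φ ≡ N * 𝔼 xs φ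
    Σ≡|xs|*𝔼 φ = sym (begin
      N * (Σ xs φ * I)  ≡⟨ solve 3 (λ n s i → n :* (s :* i) := s :* (i :* n)) refl N (Σ xs φ) I ⟩
      Σ xs φ * (I * N)  ≡⟨ cong (Σ xs φ *_) (inv*ℕtoℚ≡1 (length xs)) ⟩
      Σ xs φ * 1ℚ       ≡⟨ *-identityʳ _ ⟩
      Σ xs φ            ∎)
      where open ≡-Reasoning

    𝔼-swap : ∀ (φ : A → A → ℚ) → 𝔼 xs (λ x → 𝔼 xs (φ x)) ≡ 𝔼 xs (λ y → 𝔼 xs (λ x → φ x y))
    𝔼-swap φ = begin
      Σ xs (λ x → Σ xs (φ x) * I) * I              ≡⟨ cong (_* I) (Σ-*ʳ xs I (λ x → Σ xs (φ x))) ⟩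
      Σ xs (λ x → Σ xs (φ x)) * I * I              ≡⟨ cong (λ s → s * I * I) (Σ-swap xs xs φ) ⟩
      Σ xs (λ y → Σ xs (λ x → φ x y)) * I * I      ≡⟨ cong (_* I) (Σ-*ʳ xs I (λ y → Σ xs (λ x → φ x y))) ⟨
      Σ xs (λ y → Σ xs (λ x → φ x y) * I) * I      ∎
      where open ≡-Reasoning

    𝔼*𝔼 : ∀ φ ψ → 𝔼 xs φ * 𝔼 xs ψ ≡ 𝔼 xs (λ x → 𝔼 xs (λ y → φ x * ψ y))
    𝔼*𝔼 φ ψ = sym (trans (𝔼-cong (λ x → 𝔼-*ˡ (φ x) ψ)) (𝔼-*ʳ (𝔼 xs ψ) φ))

    𝔼-variance : ∀ φ → let m = 𝔼 xs φ in
                 𝔼 xs (λ x → (φ x - m) * (φ x - m)) ≡ 𝔼 xs (λ x → φ x * φ x) - m * m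
    𝔼-variance φ = begin
      𝔼 xs (λ x → (φ x - m) * (φ x - m))
        ≡⟨ 𝔼-cong (λ x → solve 2 (λ y m → (y :- m) :* (y :- m) := y :* y :+ (:- (m :+ m)) :* y :+ m :* m) refl (φ x) m) ⟩
      𝔼 xs (λ x → φ x * φ x + c * φ x + m * m)
        ≡⟨ 𝔼-+ (λ x → φ x * φ x + c * φ x) (λ _ → m * m) ⟩
      𝔼 xs (λ x → φ x * φ x + c * φ x) + 𝔼 xs (λ _ → m * m)
        ≡⟨ cong₂ _+_ (𝔼-+ (λ x → φ x * φ x) (λ x → c * φ x)) (𝔼-const (m * m)) ⟩
      𝔼 xs (λ x → φ x * φ x) + 𝔼 xs (λ x → c * φ x) + m * m
        ≡⟨ cong (λ t → 𝔼 xs (λ x → φ x * φ x) + t + m * m) (𝔼-*ˡ c φ) ⟩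
      𝔼 xs (λ x → φ x * φ x) + c * m + m * m
        ≡⟨ solve 2 (λ s m → s :+ (:- (m :+ m)) :* m :+ m :* m := s :- m :* m) refl (𝔼 xs (λ x → φ x * φ x)) m ⟩
      𝔼 xs (λ x → φ x * φ x) - m * m ∎
      where
      open ≡-Reasoning
      m = 𝔼 xs φ
      c = - (m + m)

    𝔼[φ]²≤𝔼[φ²] : ∀ φ → 𝔼 xs φ * 𝔼 xs φ ≤ 𝔼 xs (λ x → φ x * φ x)
    𝔼[φ]²≤𝔼[φ²] φ = 0≤q-p⇒p≤q (subst (0ℚ ≤_) (𝔼-variance φ) (𝔼-nonNeg (λ x → 0≤p*p (φ x - 𝔼 xs φ))))

    𝔼[w*φ]²≤𝔼[φ²] : ∀ {w : A → ℚ} (φ : A → ℚ) → (∀ x → w x * w x ≤ 1ℚ) →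
                     𝔼 xs (λ x → w x * φ x) * 𝔼 xs (λ x → w x * φ x) ≤ 𝔼 xs (λ x → φ x * φ x)
    𝔼[w*φ]²≤𝔼[φ²] {w} φ w²≤1 = ≤-trans (𝔼[φ]²≤𝔼[φ²] (λ x → w x * φ x)) (𝔼-mono λ x → begin
      w x * φ x * (w x * φ x)  ≡⟨ solve 2 (λ w y → w :* y :* (w :* y) := (w :* w) :* (y :* y)) refl (w x) (φ x) ⟩
      w x * w x * (φ x * φ x)  ≤⟨ *-monoʳ-≤-nonNeg (φ x * φ x) {{nonNegative (0≤p*p (φ x))}} (w²≤1 x) ⟩
      1ℚ * (φ x * φ x)         ≡⟨ *-identityˡ _ ⟩
      φ x * φ x                ∎)
      where open ≤-Reasoning

    Σ²≤|xs|²*bound : ∀ {φ B} → (∀ x → φ x * φ x ≤ B) → Σ xs φ * Σ xs φ ≤ (N * N) * B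
    Σ²≤|xs|²*bound {φ} {B} φ²≤B = begin
      Σ xs φ * Σ xs φ                 ≡⟨ cong₂ _*_ (Σ≡|xs|*𝔼 φ) (Σ≡|xs|*𝔼 φ) ⟩
      N * 𝔼 xs φ * (N * 𝔼 xs φ)       ≡⟨ solve 2 (λ n e → n :* e :* (n :* e) := (n :* n) :* (e :* e)) refl N (𝔼 xs φ) ⟩
      N * N * (𝔼 xs φ * 𝔼 xs φ)       ≤⟨ *-monoˡ-≤-nonNeg (N * N) {{nonNegative (0≤p*p N)}}
                                           (≤-trans (𝔼[φ]²≤𝔼[φ²] φ) (𝔼-mono φ²≤B)) ⟩
      N * N * 𝔼 xs (λ _ → B)          ≡⟨ cong (N * N *_) (𝔼-const B) ⟩
      N * N * B                       ∎
      where open ≤-Reasoning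

module VectorSpace (p : ℕ) .{{_ : NonZero p}} where

  open import Data.Nat as ℕ using (zero; suc; _%_; _∸_; _<_)
  open import Data.Nat.Properties as ℕ using ()
  open import Data.Nat.DivMod
  open import Data.Fin using (Fin; toℕ)
  open import Data.Fin.Properties using (toℕ-injective; toℕ-fromℕ<; toℕ<n)
  open import Data.List using (List; []; _∷_; length; map; concatMap; allFin)
  open import Data.List.Properties using (length-++; length-map; length-tabulate)
  open import Data.Vec using ([]; _∷_)
  open import Data.Vec.Properties using (zipWith-comm; zipWith-assoc)
  open import Relation.Binary.PropositionalEquality
  open ListSums using (Σ; Σ-cong; Σ-map; Σ-concatMap; Σ-allFin-permute)
  open Field p

  [m%p+n]%p≡[m+n]%p : ∀ m n → (m % p ℕ.+ n) % p ≡ (m ℕ.+ n) % p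
  [m%p+n]%p≡[m+n]%p m n = begin
    (m % p ℕ.+ n) % p              ≡⟨ %-distribˡ-+ (m % p) n p ⟩
    (m % p % p ℕ.+ n % p) % p      ≡⟨ cong (λ k → (k ℕ.+ n % p) % p) (m%n%n≡m%n m p) ⟩
    (m % p ℕ.+ n % p) % p          ≡⟨ %-distribˡ-+ m n p ⟨
    (m ℕ.+ n) % p                  ∎
    where open ≡-Reasoning

  [m+n%p]%p≡[m+n]%p : ∀ m n → (m ℕ.+ n % p) % p ≡ (m ℕ.+ n) % p
  [m+n%p]%p≡[m+n]%p m n = begin
    (m ℕ.+ n % p) % p  ≡⟨ cong (_% p) (ℕ.+-comm m (n % p)) ⟩
    (n % p ℕ.+ m) % p  ≡⟨ [m%p+n]%p≡[m+n]%p n m ⟩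
    (n ℕ.+ m) % p      ≡⟨ cong (_% p) (ℕ.+-comm n m) ⟩
    (m ℕ.+ n) % p      ∎
    where open ≡-Reasoning

  toℕ-mod : ∀ m → toℕ (m mod p) ≡ m % p
  toℕ-mod m = toℕ-fromℕ< _

  mod-cong : ∀ {m n} → m % p ≡ n % p → m mod p ≡ n mod p
  mod-cong m≡n = toℕ-injective (trans (toℕ-mod _) (trans m≡n (sym (toℕ-mod _))))

  toℕ%p : ∀ (a : Fin p) → toℕ a % p ≡ toℕ a
  toℕ%p a = m<n⇒m%n≡m (toℕ<n a)

  +ₚ-comm : ∀ a b → a +ₚ b ≡ b +ₚ a
  +ₚ-comm a b = cong (_mod p) (ℕ.+-comm (toℕ a) (toℕ b))

  +ₚ-assoc : ∀ a b c → (a +ₚ b) +ₚ c ≡ a +ₚ (b +ₚ c)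
  +ₚ-assoc a b c = mod-cong (begin
    (toℕ (a +ₚ b) ℕ.+ toℕ c) % p            ≡⟨ cong (λ k → (k ℕ.+ toℕ c) % p) (toℕ-mod _) ⟩
    ((toℕ a ℕ.+ toℕ b) % p ℕ.+ toℕ c) % p   ≡⟨ [m%p+n]%p≡[m+n]%p _ _ ⟩
    (toℕ a ℕ.+ toℕ b ℕ.+ toℕ c) % p         ≡⟨ cong (_% p) (ℕ.+-assoc (toℕ a) _ _) ⟩
    (toℕ a ℕ.+ (toℕ b ℕ.+ toℕ c)) % p       ≡⟨ [m+n%p]%p≡[m+n]%p _ _ ⟨
    (toℕ a ℕ.+ (toℕ b ℕ.+ toℕ c) % p) % p   ≡⟨ cong (λ k → (toℕ a ℕ.+ k) % p) (toℕ-mod _) ⟨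
    (toℕ a ℕ.+ toℕ (b +ₚ c)) % p            ∎)
    where open ≡-Reasoning

  -ₚ-inverseˡ : ∀ i a → i +ₚ ((-ₚ a) +ₚ a) ≡ i
  -ₚ-inverseˡ i a = toℕ-injective (begin
    toℕ (i +ₚ ((-ₚ a) +ₚ a))                       ≡⟨ toℕ-mod _ ⟩
    (toℕ i ℕ.+ toℕ ((-ₚ a) +ₚ a)) % p              ≡⟨ cong (λ k → (toℕ i ℕ.+ k) % p) (toℕ-mod _) ⟩
    (toℕ i ℕ.+ (toℕ (-ₚ a) ℕ.+ toℕ a) % p) % p     ≡⟨ cong (λ k → (toℕ i ℕ.+ (k ℕ.+ toℕ a) % p) % p) (toℕ-mod _) ⟩
    (toℕ i ℕ.+ ((p ∸ toℕ a) % p ℕ.+ toℕ a) % p) % p ≡⟨ cong (λ k → (toℕ i ℕ.+ k) % p) ([m%p+n]%p≡[m+n]%p _ _) ⟩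
    (toℕ i ℕ.+ (p ∸ toℕ a ℕ.+ toℕ a) % p) % p      ≡⟨ cong (λ k → (toℕ i ℕ.+ k % p) % p) (ℕ.m∸n+n≡m (ℕ.<⇒≤ (toℕ<n a))) ⟩
    (toℕ i ℕ.+ p % p) % p                          ≡⟨ [m+n%p]%p≡[m+n]%p _ _ ⟩
    (toℕ i ℕ.+ p) % p                              ≡⟨ [m+n]%n≡m%n _ p ⟩
    toℕ i % p                                      ≡⟨ toℕ%p i ⟩
    toℕ i                                          ∎)
    where open ≡-Reasoning

  -ₚ-cancelʳ : ∀ i a → (i +ₚ (-ₚ a)) +ₚ a ≡ i
  -ₚ-cancelʳ i a = trans (+ₚ-assoc i (-ₚ a) a) (-ₚ-inverseˡ i a)

  +ₚ-cancelʳ : ∀ i a → (i +ₚ a) +ₚ (-ₚ a) ≡ i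
  +ₚ-cancelʳ i a = begin
    (i +ₚ a) +ₚ (-ₚ a)   ≡⟨ +ₚ-assoc i a (-ₚ a) ⟩
    i +ₚ (a +ₚ (-ₚ a))   ≡⟨ cong (i +ₚ_) (+ₚ-comm a (-ₚ a)) ⟩
    i +ₚ ((-ₚ a) +ₚ a)   ≡⟨ -ₚ-inverseˡ i a ⟩
    i                    ∎
    where open ≡-Reasoning

  -ₚ-involutive : ∀ a → -ₚ (-ₚ a) ≡ a
  -ₚ-involutive a = toℕ-injective (trans (toℕ-mod _)
    (trans (cong (λ k → (p ∸ k) % p) (toℕ-mod _)) (p∸[p∸m]%p≡m (toℕ a) (toℕ<n a))))
    where
    p∸[p∸m]%p≡m : ∀ m → m < p → (p ∸ (p ∸ m) % p) % p ≡ m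
    p∸[p∸m]%p≡m zero    _   = trans (cong (λ k → (p ∸ k) % p) (n%n≡0 p)) (n%n≡0 p)
    p∸[p∸m]%p≡m (suc m) m<p = begin
      (p ∸ (p ∸ suc m) % p) % p  ≡⟨ cong (λ k → (p ∸ k) % p)
                                      (m<n⇒m%n≡m (ℕ.∸-monoʳ-< {p} {suc m} {0} (ℕ.s≤s ℕ.z≤n) (ℕ.<⇒≤ m<p))) ⟩
      (p ∸ (p ∸ suc m)) % p      ≡⟨ cong (_% p) (ℕ.m∸[m∸n]≡n (ℕ.<⇒≤ m<p)) ⟩
      suc m % p                  ≡⟨ m<n⇒m%n≡m m<p ⟩
      suc m                      ∎
      where open ≡-Reasoning

  ⊕-comm : ∀ {n} (x y : G n) → x ⊕ y ≡ y ⊕ x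
  ⊕-comm = zipWith-comm +ₚ-comm

  ⊕-assoc : ∀ {n} (x y z : G n) → (x ⊕ y) ⊕ z ≡ x ⊕ (y ⊕ z)
  ⊕-assoc = zipWith-assoc +ₚ-assoc

  length-elems : ∀ n → length (elems n) ≡ p ℕ.^ n
  length-elems zero    = refl
  length-elems (suc n) = trans
    (length-concatMap (λ a → map (a ∷_) (elems n)) (allFin p) (λ a → trans (length-map (a ∷_) (elems n)) (length-elems n)))
    (cong (ℕ._* p ℕ.^ n) (length-tabulate {n = p} (λ i → i)))
    where
    length-concatMap : ∀ {A B : Set} {k} (g : A → List B) xs → (∀ x → length (g x) ≡ k) →
                       length (concatMap g xs) ≡ length xs ℕ.* k
    length-concatMap g []       |g|≡k = refl
    length-concatMap g (x ∷ xs) |g|≡k = trans (length-++ (g x))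
      (cong₂ ℕ._+_ (|g|≡k x) (length-concatMap g xs |g|≡k))

  elems-nonZero : ∀ n → NonZero (length (elems n))
  elems-nonZero n = subst NonZero (sym (length-elems n)) (ℕ.m^n≢0 p n)

  Σ-elems-suc : ∀ n (ψ : G (suc n) → ℚ) →
                Σ (elems (suc n)) ψ ≡ Σ (allFin p) (λ i → Σ (elems n) (λ x → ψ (i ∷ x)))
  Σ-elems-suc n ψ = trans (Σ-concatMap (λ i → map (i ∷_) (elems n)) (allFin p) ψ)
    (Σ-cong (allFin p) (λ i → Σ-map (i ∷_) (elems n) ψ))

  Σ-elems-⊕ : ∀ n (a : G n) (ψ : G n → ℚ) → Σ (elems n) (λ x → ψ (x ⊕ a)) ≡ Σ (elems n) ψ
  Σ-elems-⊕ zero    []       ψ = refl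
  Σ-elems-⊕ (suc n) (a ∷ as) ψ = begin
    Σ (elems (suc n)) (λ x → ψ (x ⊕ (a ∷ as)))
      ≡⟨ Σ-elems-suc n _ ⟩
    Σ (allFin p) (λ i → Σ (elems n) (λ x → ψ ((i +ₚ a) ∷ (x ⊕ as))))
      ≡⟨ Σ-cong (allFin p) (λ i → Σ-elems-⊕ n as (λ x → ψ ((i +ₚ a) ∷ x))) ⟩
    Σ (allFin p) (λ i → Σ (elems n) (λ x → ψ ((i +ₚ a) ∷ x)))
      ≡⟨ Σ-allFin-permute (λ j → Σ (elems n) (λ x → ψ (j ∷ x))) (_+ₚ a) (_+ₚ (-ₚ a))
           (λ i → -ₚ-cancelʳ i a) (λ i → +ₚ-cancelʳ i a) ⟩
    Σ (allFin p) (λ i → Σ (elems n) (λ x → ψ (i ∷ x)))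
      ≡⟨ Σ-elems-suc n ψ ⟨
    Σ (elems (suc n)) ψ ∎
    where open ≡-Reasoning

  Σ-elems-⊖ : ∀ n (ψ : G n → ℚ) → Σ (elems n) (λ x → ψ (⊖ x)) ≡ Σ (elems n) ψ
  Σ-elems-⊖ zero    ψ = refl
  Σ-elems-⊖ (suc n) ψ = begin
    Σ (elems (suc n)) (λ x → ψ (⊖ x))
      ≡⟨ Σ-elems-suc n _ ⟩
    Σ (allFin p) (λ i → Σ (elems n) (λ x → ψ ((-ₚ i) ∷ (⊖ x))))
      ≡⟨ Σ-cong (allFin p) (λ i → Σ-elems-⊖ n (λ x → ψ ((-ₚ i) ∷ x))) ⟩
    Σ (allFin p) (λ i → Σ (elems n) (λ x → ψ ((-ₚ i) ∷ x)))
      ≡⟨ Σ-allFin-permute (λ j → Σ (elems n) (λ x → ψ (j ∷ x))) -ₚ_ -ₚ_ -ₚ-involutive -ₚ-involutive ⟩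
    Σ (allFin p) (λ i → Σ (elems n) (λ x → ψ (i ∷ x)))
      ≡⟨ Σ-elems-suc n ψ ⟨
    Σ (elems (suc n)) ψ ∎
    where open ≡-Reasoning

module RootBounds where

  import Data.Integer as ℤ
  open import Data.Sum using (inj₁; inj₂; [_,_]′)
  open import Data.Unit using (tt)
  open import Data.Rational
  open import Data.Rational.Properties
  open import Data.Rational.Solver
  open import Relation.Binary.PropositionalEquality
  open import Relation.Nullary using (yes; no)
  open RationalLemmas
  open +-*-Solver

  LeScaledRoot-4-1 : ∀ {x m ε} → x ≤ ℕtoℚ 4 * m → ℕtoℚ 256 * (m * m * (m * m)) ≤ ε →
                     LeScaledRoot 4 1ℚ ε x
  LeScaledRoot-4-1 {x} {m} {ε} x≤4m 256m⁴≤ε with x ≤? 0ℚ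
  ... | yes x≤0 = inj₁ x≤0
  ... | no x≰0  = inj₂ (begin
    x * (x * (x * (x * 1ℚ)))                 ≡⟨ solve 1 (λ x → x :* (x :* (x :* (x :* con 1ℚ))) := (x :* x) :* (x :* x)) refl x ⟩
    x * x * (x * x)                          ≤⟨ *-mono-≤-nonNeg (0≤p*p x) (0≤p*p 4m) x²≤[4m]² x²≤[4m]² ⟩
    4m * 4m * (4m * 4m)                      ≡⟨ solve 1 (λ m → (con (ℕtoℚ 4) :* m) :* (con (ℕtoℚ 4) :* m) :* ((con (ℕtoℚ 4) :* m) :* (con (ℕtoℚ 4) :* m))
                                                      := con (ℕtoℚ 256) :* (m :* m :* (m :* m))) refl m ⟩
    ℕtoℚ 256 * (m * m * (m * m))             ≤⟨ 256m⁴≤ε ⟩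
    ε                                        ≡⟨ *-identityˡ ε ⟨
    1ℚ * (1ℚ * (1ℚ * (1ℚ * 1ℚ))) * ε         ∎)
    where
    open ≤-Reasoning
    4m = ℕtoℚ 4 * m
    0≤x = <⇒≤ (≰⇒> x≰0)
    x²≤[4m]² = *-mono-≤-nonNeg 0≤x (≤-trans 0≤x x≤4m) x≤4m x≤4m

  ¼ : ℚ
  ¼ = ℤ.+ 1 / 4

  x²≤400M²ε-small : ∀ {x M ε} → 0ℚ ≤ ε → ε ≤ ¼ →
              x * x ≤ ℕtoℚ 4096 * (M * M * (ε * ε * ε)) → x * x ≤ ℕtoℚ 400 * (M * M * ε)
  x²≤400M²ε-small {x} {M} {ε} 0≤ε ε≤¼ x²≤4096M²ε³ = begin
    x * x                                ≤⟨ x²≤4096M²ε³ ⟩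
    ℕtoℚ 4096 * (M * M * (ε * ε * ε))    ≡⟨ solve 2 (λ m e → con (ℕtoℚ 4096) :* (m :* m :* (e :* e :* e))
                                                := con (ℕtoℚ 4096) :* (e :* e) :* (m :* m :* e)) refl M ε ⟩
    ℕtoℚ 4096 * (ε * ε) * (M * M * ε)    ≤⟨ *-monoʳ-≤-nonNeg (M * M * ε) {{nonNegative 0≤M²ε}}
                                               (*-monoˡ-≤-nonNeg (ℕtoℚ 4096) (*-mono-≤-nonNeg 0≤ε (≤ᵇ⇒≤ tt) ε≤¼ ε≤¼)) ⟩
    ℕtoℚ 4096 * (¼ * ¼) * (M * M * ε)    ≤⟨ *-monoʳ-≤-nonNeg (M * M * ε) {{nonNegative 0≤M²ε}}
                                               (≤ᵇ⇒≤ {ℕtoℚ 4096 * (¼ * ¼)} {ℕtoℚ 400} tt) ⟩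
    ℕtoℚ 400 * (M * M * ε)               ∎
    where
    open ≤-Reasoning
    0≤M²ε = *-nonNeg (0≤p*p M) 0≤ε

  x²≤400M²ε-large : ∀ {x M ε} → ¼ ≤ ε → x * x ≤ M * M → x * x ≤ ℕtoℚ 400 * (M * M * ε)
  x²≤400M²ε-large {x} {M} {ε} ¼≤ε x²≤M² = begin
    x * x                   ≤⟨ x²≤M² ⟩
    M * M                   ≡⟨ *-identityʳ (M * M) ⟨
    M * M * 1ℚ              ≤⟨ *-monoˡ-≤-nonNeg (M * M) {{nonNegative (0≤p*p M)}}
                                 (≤-trans (≤ᵇ⇒≤ {1ℚ} {ℕtoℚ 400 * ¼} tt) (*-monoˡ-≤-nonNeg (ℕtoℚ 400) ¼≤ε)) ⟩
    M * M * (ℕtoℚ 400 * ε)  ≡⟨ solve 2 (λ m e → m :* m :* (con (ℕtoℚ 400) :* e) := con (ℕtoℚ 400) :* (m :* m :* e)) refl M ε ⟩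
    ℕtoℚ 400 * (M * M * ε)  ∎
    where open ≤-Reasoning

  -- The goal is x² ≤ 400 M² ε.  For ε ≤ 1/4 it follows from x² ≤ 4096 M² ε³, otherwise from x² ≤ M².
  LeScaledRoot-2-20 : ∀ {x M ε} → 0ℚ ≤ ε → x * x ≤ M * M →
                      x * x ≤ ℕtoℚ 4096 * (M * M * (ε * ε * ε)) →
                      LeScaledRoot 2 (ℕtoℚ 20 * M) ε x
  LeScaledRoot-2-20 {x} {M} {ε} 0≤ε x²≤M² x²≤4096M²ε³ = inj₂ (begin
    x * (x * 1ℚ)                          ≡⟨ cong (x *_) (*-identityʳ x) ⟩
    x * x                                 ≤⟨ [ (λ ε≤¼ → x²≤400M²ε-small {x} {M} 0≤ε ε≤¼ x²≤4096M²ε³)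
                                             , (λ ¼≤ε → x²≤400M²ε-large {x} {M} ¼≤ε x²≤M²) ]′ (≤-total ε ¼) ⟩
    ℕtoℚ 400 * (M * M * ε)                ≡⟨ solve 2 (λ m e → con (ℕtoℚ 400) :* (m :* m :* e)
                                                := con (ℕtoℚ 20) :* m :* (con (ℕtoℚ 20) :* m :* con 1ℚ) :* e) refl M ε ⟩
    ℕtoℚ 20 * M * (ℕtoℚ 20 * M * 1ℚ) * ε  ∎)
    where open ≤-Reasoning

module Counting (ε : ℚ) (0≤ε : 0ℚ ≤ ε) where

  open import Data.List using (List; length)
  open import Data.Unit using (tt)
  open import Data.Rational
  open import Data.Rational.Properties
  open import Data.Rational.Solver
  open import Relation.Binary.PropositionalEquality
  open import Relation.Nullary using (Dec; yes; no; ¬_; ¬?; contradiction)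
  open RationalLemmas
  open ListSums
  open +-*-Solver hiding (⟦_⟧)

  -- Small u says ∣ u ∣ ≤ ε^(1/4) / 4.
  Small : ℚ → Set
  Small u = ℕtoℚ 256 * (u * u * (u * u)) ≤ ε

  Small? : ∀ u → Dec (Small u)
  Small? u = _ ≤? ε

  Big? : ∀ u → Dec (¬ Small u)
  Big? u = ¬? (Small? u)

  ¬Small⇒0<u² : ∀ u → ¬ Small u → 0ℚ < u * u
  ¬Small⇒0<u² u ¬small with u * u ≤? 0ℚ
  ... | no u²≰0  = ≰⇒> u²≰0
  ... | yes u²≤0 = contradiction
    (subst (λ w → ℕtoℚ 256 * (w * w) ≤ ε) (≤-antisym (0≤p*p u) u²≤0)
      (≤-trans (≤ᵇ⇒≤ {ℕtoℚ 256 * (0ℚ * 0ℚ)} {0ℚ} tt) 0≤ε))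
    ¬small

  ⟦Big⟧*⟦Big⟧*ε≤ : ∀ u v → ⟦ Big? u ⟧ * ⟦ Big? v ⟧ * ε ≤ ℕtoℚ 256 * (u * u * (v * v))
  ⟦Big⟧*⟦Big⟧*ε≤ u v = bound (Small? u) (Small? v)
    where
    0≤rhs : 0ℚ ≤ ℕtoℚ 256 * (u * u * (v * v))
    0≤rhs = *-nonNeg (0≤ℕtoℚ 256) (*-nonNeg (0≤p*p u) (0≤p*p v))
    bound : (u? : Dec (Small u)) (v? : Dec (Small v)) →
            ⟦ ¬? u? ⟧ * ⟦ ¬? v? ⟧ * ε ≤ ℕtoℚ 256 * (u * u * (v * v))
    bound (yes _) v? = subst (_≤ _) (sym (trans (cong (_* ε) (*-zeroˡ ⟦ ¬? v? ⟧)) (*-zeroˡ ε))) 0≤rhs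
    bound (no _) (yes _) = subst (_≤ _) (sym (trans (cong (_* ε) (*-zeroʳ 1ℚ)) (*-zeroˡ ε))) 0≤rhs
    bound (no ¬su) (no ¬sv) = begin
      1ℚ * 1ℚ * ε                   ≡⟨ *-identityˡ ε ⟩
      ε                             ≤⟨ p*p≤q*q⇒p≤q 0≤rhs (begin
        ε * ε                                                ≤⟨ *-mono-≤-nonNeg 0≤ε (≤-trans 0≤ε (<⇒≤ ε<v)) (<⇒≤ ε<u) (<⇒≤ ε<v) ⟩
        ℕtoℚ 256 * (u * u * (u * u)) * (ℕtoℚ 256 * (v * v * (v * v)))
          ≡⟨ solve 2 (λ u v → con (ℕtoℚ 256) :* (u :* u :* (u :* u)) :* (con (ℕtoℚ 256) :* (v :* v :* (v :* v)))
                  := con (ℕtoℚ 256) :* (u :* u :* (v :* v)) :* (con (ℕtoℚ 256) :* (u :* u :* (v :* v)))) refl u v ⟩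
        ℕtoℚ 256 * (u * u * (v * v)) * (ℕtoℚ 256 * (u * u * (v * v))) ∎) ⟩
      ℕtoℚ 256 * (u * u * (v * v))  ∎
      where
      open ≤-Reasoning
      ε<u = ≰⇒> ¬su
      ε<v = ≰⇒> ¬sv

  module _ {X : Set} (xs : List X) (u : X → ℚ) where

    private
      K W k : ℚ
      K = Σ xs (λ x → ⟦ Big? (u x) ⟧)
      W = Σ xs (λ x → u x * u x)
      k = ℕtoℚ (length xs)

    -- Chebyshev's inequality for u², squared so as to avoid a square root of ε.
    #Big²*ε≤ : K * K * ε ≤ ℕtoℚ 256 * (W * W)
    #Big²*ε≤ = begin
      K * K * ε
        ≡⟨ cong (_* ε) (Σ*Σ xs xs _ _) ⟩
      Σ xs (λ x → Σ xs (λ y → ⟦ Big? (u x) ⟧ * ⟦ Big? (u y) ⟧)) * ε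
        ≡⟨ Σ-*ʳ xs ε _ ⟨
      Σ xs (λ x → Σ xs (λ y → ⟦ Big? (u x) ⟧ * ⟦ Big? (u y) ⟧) * ε)
        ≡⟨ Σ-cong xs (λ x → Σ-*ʳ xs ε _) ⟨
      Σ xs (λ x → Σ xs (λ y → ⟦ Big? (u x) ⟧ * ⟦ Big? (u y) ⟧ * ε))
        ≤⟨ Σ-mono xs (λ x → Σ-mono xs (λ y → ⟦Big⟧*⟦Big⟧*ε≤ (u x) (u y))) ⟩
      Σ xs (λ x → Σ xs (λ y → ℕtoℚ 256 * (u x * u x * (u y * u y))))
        ≡⟨ Σ-cong xs (λ x → Σ-*ˡ xs (ℕtoℚ 256) _) ⟩
      Σ xs (λ x → ℕtoℚ 256 * Σ xs (λ y → u x * u x * (u y * u y)))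
        ≡⟨ Σ-*ˡ xs (ℕtoℚ 256) _ ⟩
      ℕtoℚ 256 * Σ xs (λ x → Σ xs (λ y → u x * u x * (u y * u y)))
        ≡⟨ cong (ℕtoℚ 256 *_) (Σ*Σ xs xs _ _) ⟨
      ℕtoℚ 256 * (W * W) ∎
      where open ≤-Reasoning

    #Big²≤ : W ≤ k * (ε * ε) → K * K ≤ k * k * (ℕtoℚ 256 * (ε * ε * ε))
    #Big²≤ W≤kε² = bound (ε ≤? 0ℚ)
      where
      0≤W = Σ-nonNeg xs (λ x → 0≤p*p (u x))
      bound : Dec (ε ≤ 0ℚ) → K * K ≤ k * k * (ℕtoℚ 256 * (ε * ε * ε))
      -- For ε = 0 the Chebyshev bound is vacuous, but then every u x vanishes.
      bound (yes ε≤0) = subst (λ K → K * K ≤ k * k * (ℕtoℚ 256 * (ε * ε * ε)))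
        (sym (Σ⟦⟧≡0 (λ x → Big? (u x)) xs (λ x → 0≤p*p (u x)) (λ x → ¬Small⇒0<u² (u x))
          (≤-trans W≤kε² (≤-reflexive kε²≡0))))
        (*-nonNeg (0≤p*p k) (*-nonNeg (0≤ℕtoℚ 256) (*-nonNeg (0≤p*p ε) 0≤ε)))
        where
        kε²≡0 : k * (ε * ε) ≡ 0ℚ
        kε²≡0 = trans (cong (λ e → k * (e * e)) (≤-antisym ε≤0 0≤ε)) (*-zeroʳ k)
      bound (no ε≰0) = *-cancelʳ-≤-pos ε {{positive (≰⇒> ε≰0)}} (begin
        K * K * ε                                      ≤⟨ #Big²*ε≤ ⟩
        ℕtoℚ 256 * (W * W)                             ≤⟨ *-monoˡ-≤-nonNeg (ℕtoℚ 256)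
                                                            (*-mono-≤-nonNeg 0≤W 0≤kε² W≤kε² W≤kε²) ⟩
        ℕtoℚ 256 * (k * (ε * ε) * (k * (ε * ε)))       ≡⟨ solve 2 (λ k e → con (ℕtoℚ 256) :* (k :* (e :* e) :* (k :* (e :* e)))
                                                             := k :* k :* (con (ℕtoℚ 256) :* (e :* e :* e)) :* e) refl k ε ⟩
        k * k * (ℕtoℚ 256 * (ε * ε * ε)) * ε           ∎)
        where
        open ≤-Reasoning
        0≤kε² = *-nonNeg (0≤ℕtoℚ (length xs)) (0≤p*p ε)

module Variety (p : ℕ) .{{_ : NonZero p}} (n : ℕ) where

  open import Data.Nat as ℕ using ()
  open import Data.List using (length)
  open import Data.Product using (_×_; _,_; proj₁; proj₂)
  open import Data.Sum using (_⊎_; inj₁; inj₂)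
  open import Data.Rational
  open import Data.Rational.Properties
  open import Data.Rational.Solver
  open import Relation.Binary.PropositionalEquality
  open import Relation.Nullary using (yes; no; ¬_; ¬?; contradiction)
  open import Relation.Nullary.Decidable using (_⊎-dec_)
  open import Function using (id)
  open RationalLemmas
  open ListSums
  open RootBounds
  open +-*-Solver hiding (⟦_⟧)
  open Field p
  open Gowers p n
  open VectorSpace p

  instance
    _ : ℕ.NonZero (length (elems n))
    _ = elems-nonZero n

  open Expectation (elems n)

  Σᴳ 𝔼ᴳ : (G n → ℚ) → ℚ
  Σᴳ = Σ (elems n)
  𝔼ᴳ = 𝔼 (elems n)

  𝔼-⊕ʳ : ∀ a (ψ : G n → ℚ) → 𝔼ᴳ (λ x → ψ (x ⊕ a)) ≡ 𝔼ᴳ ψ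
  𝔼-⊕ʳ a ψ = cong (_* inv (length (elems n))) (Σ-elems-⊕ n a ψ)

  𝔼-⊕ˡ : ∀ a (ψ : G n → ℚ) → 𝔼ᴳ (λ x → ψ (a ⊕ x)) ≡ 𝔼ᴳ ψ
  𝔼-⊕ˡ a ψ = trans (𝔼-cong (λ x → cong ψ (⊕-comm a x))) (𝔼-⊕ʳ a ψ)

  Σ-⊝ : ∀ d (ψ : G n → ℚ) → Σᴳ (λ x → ψ (d ⊝ x)) ≡ Σᴳ ψ
  Σ-⊝ d ψ = trans (Σ-cong (elems n) (λ x → cong ψ (⊕-comm d (⊖ x))))
    (trans (Σ-elems-⊖ n (λ y → ψ (y ⊕ d))) (Σ-elems-⊕ n d ψ))

  ⊕-swapʳ : ∀ (x y z : G n) → (x ⊕ y) ⊕ z ≡ (x ⊕ z) ⊕ y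
  ⊕-swapʳ x y z = trans (⊕-assoc x y z) (trans (cong (x ⊕_) (⊕-comm y z)) (sym (⊕-assoc x z y)))

  autocorr : (G n → ℚ) → G n → ℚ
  autocorr f h = 𝔼ᴳ (λ w → f w * f (w ⊕ h))

  U2⁴≡𝔼[autocorr²] : ∀ f → U2⁴ f ≡ 𝔼ᴳ (λ h → autocorr f h * autocorr f h)
  U2⁴≡𝔼[autocorr²] f = sym (begin
    𝔼ᴳ (λ h → autocorr f h * autocorr f h)
      ≡⟨ 𝔼-cong (λ h → 𝔼*𝔼 (λ w → f w * f (w ⊕ h)) (λ v → f v * f (v ⊕ h))) ⟩
    𝔼ᴳ (λ h → 𝔼ᴳ (λ w → 𝔼ᴳ (λ v → f w * f (w ⊕ h) * (f v * f (v ⊕ h)))))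
      ≡⟨ 𝔼-cong (λ h → 𝔼-cong (λ w → 𝔼-⊕ˡ w (λ v → f w * f (w ⊕ h) * (f v * f (v ⊕ h))))) ⟨
    𝔼ᴳ (λ h → 𝔼ᴳ (λ w → 𝔼ᴳ (λ b → f w * f (w ⊕ h) * (f (w ⊕ b) * f ((w ⊕ b) ⊕ h)))))
      ≡⟨ 𝔼-swap (λ h w → 𝔼ᴳ (λ b → f w * f (w ⊕ h) * (f (w ⊕ b) * f ((w ⊕ b) ⊕ h)))) ⟩
    𝔼ᴳ (λ w → 𝔼ᴳ (λ h → 𝔼ᴳ (λ b → f w * f (w ⊕ h) * (f (w ⊕ b) * f ((w ⊕ b) ⊕ h)))))
      ≡⟨ 𝔼-cong (λ w → 𝔼-cong (λ h → 𝔼-cong (λ b → reorder w h b))) ⟩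
    U2⁴ f ∎)
    where
    open ≡-Reasoning
    reorder : ∀ w h b → f w * f (w ⊕ h) * (f (w ⊕ b) * f ((w ⊕ b) ⊕ h)) ≡ ∂ h (∂ b f) w
    reorder w h b = trans (cong (λ z → f w * f (w ⊕ h) * (f (w ⊕ b) * f z)) (⊕-swapʳ w b h))
      (solve 4 (λ a b c d → a :* b :* (c :* d) := d :* b :* (c :* a)) refl
        (f w) (f (w ⊕ h)) (f (w ⊕ b)) (f ((w ⊕ h) ⊕ b)))

  corr : (G n → ℚ) → (G n → ℚ) → G n → ℚ
  corr A f d = 𝔼ᴳ (λ x → A x * f (x ⊕ d))

  𝔼[corr²]²≤U2⁴ : ∀ {A : G n → ℚ} f → (∀ x → A x * A x ≤ 1ℚ) →
                  let c = 𝔼ᴳ (λ d → corr A f d * corr A f d) in c * c ≤ U2⁴ f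
  𝔼[corr²]²≤U2⁴ {A} f A²≤1 = begin
    𝔼ᴳ (λ d → corr A f d * corr A f d) * 𝔼ᴳ (λ d → corr A f d * corr A f d)
      ≡⟨ cong₂ _*_ 𝔼[corr²]≡𝔼[A*R] 𝔼[corr²]≡𝔼[A*R] ⟩
    𝔼ᴳ (λ x → A x * R x) * 𝔼ᴳ (λ x → A x * R x)  ≤⟨ 𝔼[w*φ]²≤𝔼[φ²] {A} R A²≤1 ⟩
    𝔼ᴳ (λ x → R x * R x)                          ≤⟨ 𝔼-mono R²≤U2⁴ ⟩
    𝔼ᴳ (λ _ → U2⁴ f)                              ≡⟨ 𝔼-const (U2⁴ f) ⟩
    U2⁴ f                                         ∎
    where
    open ≤-Reasoning
    C : G n → G n → ℚ
    C x y = 𝔼ᴳ (λ d → f (x ⊕ d) * f (y ⊕ d))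
    R : G n → ℚ
    R x = 𝔼ᴳ (λ y → A y * C x y)

    C-diag : ∀ x h → C x (x ⊕ h) ≡ autocorr f h
    C-diag x h = trans (𝔼-cong (λ d → cong (λ z → f (x ⊕ d) * f z) (⊕-swapʳ x h d)))
      (𝔼-⊕ˡ x (λ w → f w * f (w ⊕ h)))

    R²≤U2⁴ : ∀ x → R x * R x ≤ U2⁴ f
    R²≤U2⁴ x = ≤-trans (𝔼[w*φ]²≤𝔼[φ²] {A} (C x) A²≤1) (≤-reflexive (begin-equality
      𝔼ᴳ (λ y → C x y * C x y)                ≡⟨ 𝔼-⊕ˡ x (λ y → C x y * C x y) ⟨
      𝔼ᴳ (λ h → C x (x ⊕ h) * C x (x ⊕ h))    ≡⟨ 𝔼-cong (λ h → cong₂ _*_ (C-diag x h) (C-diag x h)) ⟩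
      𝔼ᴳ (λ h → autocorr f h * autocorr f h)  ≡⟨ U2⁴≡𝔼[autocorr²] f ⟨
      U2⁴ f                                   ∎))

    𝔼[corr²]≡𝔼[A*R] : 𝔼ᴳ (λ d → corr A f d * corr A f d) ≡ 𝔼ᴳ (λ x → A x * R x)
    𝔼[corr²]≡𝔼[A*R] = begin-equality
      𝔼ᴳ (λ d → corr A f d * corr A f d)
        ≡⟨ 𝔼-cong (λ d → 𝔼*𝔼 (λ x → A x * f (x ⊕ d)) (λ y → A y * f (y ⊕ d))) ⟩
      𝔼ᴳ (λ d → 𝔼ᴳ (λ x → 𝔼ᴳ (λ y → A x * f (x ⊕ d) * (A y * f (y ⊕ d)))))
        ≡⟨ 𝔼-swap (λ d x → 𝔼ᴳ (λ y → A x * f (x ⊕ d) * (A y * f (y ⊕ d)))) ⟩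
      𝔼ᴳ (λ x → 𝔼ᴳ (λ d → 𝔼ᴳ (λ y → A x * f (x ⊕ d) * (A y * f (y ⊕ d)))))
        ≡⟨ 𝔼-cong (λ x → 𝔼-swap (λ d y → A x * f (x ⊕ d) * (A y * f (y ⊕ d)))) ⟩
      𝔼ᴳ (λ x → 𝔼ᴳ (λ y → 𝔼ᴳ (λ d → A x * f (x ⊕ d) * (A y * f (y ⊕ d)))))
        ≡⟨ 𝔼-cong (λ x → 𝔼-cong (λ y → 𝔼-cong (λ d →
             solve 4 (λ a b c d → a :* c :* (b :* d) := a :* (b :* (c :* d))) refl
               (A x) (A y) (f (x ⊕ d)) (f (y ⊕ d))))) ⟩
      𝔼ᴳ (λ x → 𝔼ᴳ (λ y → 𝔼ᴳ (λ d → A x * (A y * (f (x ⊕ d) * f (y ⊕ d))))))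
        ≡⟨ 𝔼-cong (λ x → trans (𝔼-cong (λ y → trans (𝔼-*ˡ (A x) _) (cong (A x *_) (𝔼-*ˡ (A y) _))))
             (𝔼-*ˡ (A x) _)) ⟩
      𝔼ᴳ (λ x → A x * R x) ∎

  module Telescoping (V : G n → Bool) (δ : ℚ) (𝔼[𝟙V]≡δ : 𝔼ᴳ (𝟙 V) ≡ δ) where

    g f : G n → ℚ
    g = 𝟙 V
    f x = 𝟙 V x - δ

    0≤δ≤1 : 0≤ δ ≤1
    0≤δ≤1 = subst (0ℚ ≤_) 𝔼[𝟙V]≡δ (𝔼-nonNeg (λ x → proj₁ (0≤𝟙≤1 V x)))
          , subst₂ _≤_ 𝔼[𝟙V]≡δ (𝔼-const 1ℚ) (𝔼-mono (λ x → proj₂ (0≤𝟙≤1 V x)))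

    𝔼[A*g]≡δ𝔼[A]+corr : ∀ A d → 𝔼ᴳ (λ x → A x * g (x ⊕ d)) ≡ δ * 𝔼ᴳ A + corr A f d
    𝔼[A*g]≡δ𝔼[A]+corr A d = begin
      𝔼ᴳ (λ x → A x * g (x ⊕ d))                   ≡⟨ 𝔼-cong (λ x → solve 3 (λ a y δ → a :* y := δ :* a :+ a :* (y :- δ))
                                                                       refl (A x) (g (x ⊕ d)) δ) ⟩
      𝔼ᴳ (λ x → δ * A x + A x * f (x ⊕ d))         ≡⟨ 𝔼-+ (λ x → δ * A x) (λ x → A x * f (x ⊕ d)) ⟩
      𝔼ᴳ (λ x → δ * A x) + corr A f d              ≡⟨ cong (_+ corr A f d) (𝔼-*ˡ δ A) ⟩
      δ * 𝔼ᴳ A + corr A f d                        ∎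
      where open ≡-Reasoning

    P₁ : G n → G n → ℚ
    P₁ a x = g x * g (x ⊕ a)

    P₂ : G n → G n → G n → ℚ
    P₂ a d₁ x = P₁ a x * g (x ⊕ d₁)

    P₃ : G n → G n → G n → G n → ℚ
    P₃ a d₁ c x = P₂ a d₁ x * g (x ⊕ c)

    0≤P₁≤1 : ∀ a x → 0≤ P₁ a x ≤1
    0≤P₁≤1 a x = 0≤*≤1 (0≤𝟙≤1 V x) (0≤𝟙≤1 V (x ⊕ a))

    0≤P₂≤1 : ∀ a d₁ x → 0≤ P₂ a d₁ x ≤1
    0≤P₂≤1 a d₁ x = 0≤*≤1 (0≤P₁≤1 a x) (0≤𝟙≤1 V (x ⊕ d₁))

    0≤P₃≤1 : ∀ a d₁ c x → 0≤ P₃ a d₁ c x ≤1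
    0≤P₃≤1 a d₁ c x = 0≤*≤1 (0≤P₂≤1 a d₁ x) (0≤𝟙≤1 V (x ⊕ c))

    u₁ : G n → ℚ
    u₁ a = corr g f a

    u₂ : G n → G n → ℚ
    u₂ a d₁ = corr (P₁ a) f d₁

    u₃ : G n → G n → G n → ℚ
    u₃ a d₁ c = corr (P₂ a d₁) f c

    u₄ : G n → G n → G n → G n → ℚ
    u₄ a d₁ c d₃ = corr (P₃ a d₁ c) f d₃

    Λ≤𝔼[P₃*g] : ∀ a d₁ d₂ d₃ → Λ V a d₁ d₂ d₃ ≤ 𝔼ᴳ (λ x → P₃ a d₁ (d₁ ⊝ d₂) x * g (x ⊕ d₃))
    Λ≤𝔼[P₃*g] a d₁ d₂ d₃ = 𝔼-mono λ x → begin
      g x * g (x ⊕ a) * g (x ⊕ d₁) * g ((x ⊕ d₁) ⊕ a) * g ((x ⊕ d₁) ⊝ d₂) * g (((x ⊕ d₁) ⊝ d₂) ⊕ a)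
        * g (x ⊕ d₃) * g ((x ⊕ d₃) ⊕ a)
        ≡⟨ solve 8 (λ t₁ t₂ t₃ t₄ t₅ t₆ t₇ t₈ → t₁ :* t₂ :* t₃ :* t₄ :* t₅ :* t₆ :* t₇ :* t₈
                                            := t₁ :* t₂ :* t₃ :* t₅ :* t₇ :* (t₄ :* t₆ :* t₈)) refl
             (g x) (g (x ⊕ a)) (g (x ⊕ d₁)) (g ((x ⊕ d₁) ⊕ a)) (g ((x ⊕ d₁) ⊝ d₂))
             (g (((x ⊕ d₁) ⊝ d₂) ⊕ a)) (g (x ⊕ d₃)) (g ((x ⊕ d₃) ⊕ a)) ⟩
      g x * g (x ⊕ a) * g (x ⊕ d₁) * g ((x ⊕ d₁) ⊝ d₂) * g (x ⊕ d₃)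
        * (g ((x ⊕ d₁) ⊕ a) * g (((x ⊕ d₁) ⊝ d₂) ⊕ a) * g ((x ⊕ d₃) ⊕ a))
        ≤⟨ p*q≤p (proj₁ (0≤*≤1 (0≤*≤1 (0≤P₂≤1 a d₁ x) (0≤𝟙≤1 V _)) (0≤𝟙≤1 V _)))
                 (proj₂ (0≤*≤1 (0≤*≤1 (0≤𝟙≤1 V _) (0≤𝟙≤1 V _)) (0≤𝟙≤1 V _))) ⟩
      g x * g (x ⊕ a) * g (x ⊕ d₁) * g ((x ⊕ d₁) ⊝ d₂) * g (x ⊕ d₃)
        ≡⟨ cong (λ y → P₂ a d₁ x * g y * g (x ⊕ d₃)) (⊕-assoc x d₁ (⊖ d₂)) ⟩
      P₃ a d₁ (d₁ ⊝ d₂) x * g (x ⊕ d₃) ∎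
      where open ≤-Reasoning

    𝔼[P₃*g]-δ⁵≡ : ∀ a d₁ c d₃ → 𝔼ᴳ (λ x → P₃ a d₁ c x * g (x ⊕ d₃)) - δ ^ 5
                  ≡ δ * δ * δ * u₁ a + δ * δ * u₂ a d₁ + δ * u₃ a d₁ c + u₄ a d₁ c d₃
    𝔼[P₃*g]-δ⁵≡ a d₁ c d₃ = begin
      𝔼ᴳ (λ x → P₃ a d₁ c x * g (x ⊕ d₃)) - δ ^ 5
        ≡⟨ cong (_- δ ^ 5) (trans (𝔼[A*g]≡δ𝔼[A]+corr (P₃ a d₁ c) d₃) (cong (λ z → δ * z + u₄ a d₁ c d₃)
             (trans (𝔼[A*g]≡δ𝔼[A]+corr (P₂ a d₁) c) (cong (λ z → δ * z + u₃ a d₁ c)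
               (trans (𝔼[A*g]≡δ𝔼[A]+corr (P₁ a) d₁) (cong (λ z → δ * z + u₂ a d₁)
                 (trans (𝔼[A*g]≡δ𝔼[A]+corr g a) (cong (λ z → δ * z + u₁ a) 𝔼[𝟙V]≡δ)))))))) ⟩
      δ * (δ * (δ * (δ * δ + u₁ a) + u₂ a d₁) + u₃ a d₁ c) + u₄ a d₁ c d₃ - δ ^ 5
        ≡⟨ solve 5 (λ d x y z w → d :* (d :* (d :* (d :* d :+ x) :+ y) :+ z) :+ w :- d :* (d :* (d :* (d :* (d :* con 1ℚ))))
                                 := d :* d :* d :* x :+ d :* d :* y :+ d :* z :+ w) refl
             δ (u₁ a) (u₂ a d₁) (u₃ a d₁ c) (u₄ a d₁ c d₃) ⟩
      δ * δ * δ * u₁ a + δ * δ * u₂ a d₁ + δ * u₃ a d₁ c + u₄ a d₁ c d₃ ∎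
      where open ≡-Reasoning

    Λ-δ⁵≤Σ∣u∣ : ∀ a d₁ d₂ d₃ → let c = d₁ ⊝ d₂ in
                Λ V a d₁ d₂ d₃ - δ ^ 5 ≤ ∣ u₁ a ∣ + ∣ u₂ a d₁ ∣ + ∣ u₃ a d₁ c ∣ + ∣ u₄ a d₁ c d₃ ∣
    Λ-δ⁵≤Σ∣u∣ a d₁ d₂ d₃ = begin
      Λ V a d₁ d₂ d₃ - δ ^ 5
        ≤⟨ +-monoˡ-≤ (- (δ ^ 5)) (Λ≤𝔼[P₃*g] a d₁ d₂ d₃) ⟩
      𝔼ᴳ (λ x → P₃ a d₁ c x * g (x ⊕ d₃)) - δ ^ 5
        ≡⟨ 𝔼[P₃*g]-δ⁵≡ a d₁ c d₃ ⟩
      δ * δ * δ * u₁ a + δ * δ * u₂ a d₁ + δ * u₃ a d₁ c + u₄ a d₁ c d₃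
        ≤⟨ +-mono-≤ (+-mono-≤ (+-mono-≤ (t*p≤∣p∣ (u₁ a) (proj₁ δ³∈) (proj₂ δ³∈)) (t*p≤∣p∣ (u₂ a d₁) (proj₁ δ²∈) (proj₂ δ²∈)))
             (t*p≤∣p∣ (u₃ a d₁ c) (proj₁ 0≤δ≤1) (proj₂ 0≤δ≤1))) (p≤∣p∣ (u₄ a d₁ c d₃)) ⟩
      ∣ u₁ a ∣ + ∣ u₂ a d₁ ∣ + ∣ u₃ a d₁ c ∣ + ∣ u₄ a d₁ c d₃ ∣ ∎
      where
      open ≤-Reasoning
      c = d₁ ⊝ d₂
      δ²∈ = 0≤*≤1 0≤δ≤1 0≤δ≤1
      δ³∈ = 0≤*≤1 δ²∈ 0≤δ≤1

  Σ³ : (G n → G n → G n → ℚ) → ℚ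
  Σ³ φ = Σᴳ (λ x → Σᴳ (λ y → Σᴳ (λ z → φ x y z)))

  Σ³²≤|G|⁶*bound : ∀ {φ B} → (∀ x y z → φ x y z * φ x y z ≤ B) →
         Σ³ φ * Σ³ φ ≤ ∣G∣ * ∣G∣ * (∣G∣ * ∣G∣ * (∣G∣ * ∣G∣ * B))
  Σ³²≤|G|⁶*bound φ²≤B = Σ²≤|xs|²*bound (λ x → Σ²≤|xs|²*bound (λ y → Σ²≤|xs|²*bound (λ z → φ²≤B x y z)))

  Σ-sink₃ : ∀ (φ : G n → G n → G n → ℚ) → Σ³ φ ≡ Σ³ (λ y z x → φ x y z)
  Σ-sink₃ φ = trans (Σ-swap (elems n) (elems n) (λ x y → Σᴳ (φ x y)))
    (Σ-cong (elems n) (λ y → Σ-swap (elems n) (elems n) (λ x → φ x y)))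

  Σ-sink₄ : ∀ (φ : G n → G n → G n → G n → ℚ) →
            Σᴳ (λ x → Σ³ (φ x)) ≡ Σ³ (λ y z w → Σᴳ (λ x → φ x y z w))
  Σ-sink₄ φ = trans (Σ-swap (elems n) (elems n) (λ x y → Σᴳ (λ z → Σᴳ (φ x y z))))
    (Σ-cong (elems n) (λ y → Σ-sink₃ (λ x → φ x y)))

  Σ-quads : ∀ φ → Σ quads φ ≡ Σ³ (λ a d₁ d₂ → Σᴳ (λ d₃ → φ (a , d₁ , d₂ , d₃)))
  Σ-quads φ = trans (Σ-concatMap _ (elems n) φ) (Σ-cong (elems n) (λ a →
    trans (Σ-concatMap _ (elems n) φ) (Σ-cong (elems n) (λ d₁ →
    trans (Σ-concatMap _ (elems n) φ) (Σ-cong (elems n) (λ d₂ → Σ-map _ (elems n) φ))))))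

  module _ {c₀ δ ε : ℚ} {V : G n → Bool} (H : ApproxQuadVariety c₀ δ ε V) where
    open ApproxQuadVariety H

    𝔼[𝟙V]≡δ : 𝔼ᴳ (𝟙 V) ≡ δ
    𝔼[𝟙V]≡δ = begin
      Σᴳ (𝟙 V) * I     ≡⟨ cong (_* I) size ⟩
      δ * ∣G∣ * I      ≡⟨ *-assoc δ ∣G∣ I ⟩
      δ * (∣G∣ * I)    ≡⟨ cong (δ *_) (trans (*-comm ∣G∣ I) (inv*ℕtoℚ≡1 (length (elems n)))) ⟩
      δ * 1ℚ           ≡⟨ *-identityʳ δ ⟩
      δ                ∎
      where
      open ≡-Reasoning
      I = inv (length (elems n))

    open Telescoping V δ 𝔼[𝟙V]≡δ
    open Counting ε ε≥0

    Σ[corr²]≤∣G∣ε² : ∀ {A : G n → ℚ} → (∀ x → 0≤ A x ≤1) → Σᴳ (λ d → corr A f d * corr A f d) ≤ ∣G∣ * (ε * ε)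
    Σ[corr²]≤∣G∣ε² {A} 0≤A≤1 = begin
      Σᴳ (λ d → corr A f d * corr A f d)          ≡⟨ Σ≡|xs|*𝔼 _ ⟩
      ∣G∣ * 𝔼ᴳ (λ d → corr A f d * corr A f d)    ≤⟨ *-monoˡ-≤-nonNeg ∣G∣ {{nonNegative (0≤ℕtoℚ (length (elems n)))}}
                                                      (p*p≤q*q⇒p≤q (0≤p*p ε) (≤-trans 𝔼[corr²]²≤U2⁴f U2⁴≤ε⁴)) ⟩
      ∣G∣ * (ε * ε)                               ∎
      where
      open ≤-Reasoning
      𝔼[corr²]²≤U2⁴f = 𝔼[corr²]²≤U2⁴ {A} f (λ x → 0≤≤1⇒p*p≤1 (0≤A≤1 x))
      U2⁴≤ε⁴ : U2⁴ f ≤ ε * ε * (ε * ε)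
      U2⁴≤ε⁴ = subst (U2⁴ f ≤_) (solve 1 (λ e → e :* (e :* (e :* (e :* con 1ℚ))) := e :* e :* (e :* e)) refl ε) unif

    Small-∣∣ : ∀ u → Small u → Small ∣ u ∣
    Small-∣∣ u = subst (λ w → ℕtoℚ 256 * (w * w) ≤ ε) (sym (∣p∣*∣p∣≡p*p u))

    small⇒good : ∀ a d₁ d₂ d₃ → let c = d₁ ⊝ d₂ in
                 Small (u₁ a) → Small (u₂ a d₁) → Small (u₃ a d₁ c) → Small (u₄ a d₁ c d₃) →
                 Good V δ ε (a , d₁ , d₂ , d₃)
    small⇒good a d₁ d₂ d₃ s₁ s₂ s₃ s₄ =
      let m , small-m , Σ∣u∣≤4m = sum₄≤4*term Small
            (∣ u₁ a ∣) (∣ u₂ a d₁ ∣) (∣ u₃ a d₁ (d₁ ⊝ d₂) ∣) (∣ u₄ a d₁ (d₁ ⊝ d₂) d₃ ∣)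
            (Small-∣∣ (u₁ a) s₁) (Small-∣∣ (u₂ a d₁) s₂) (Small-∣∣ (u₃ a d₁ (d₁ ⊝ d₂)) s₃)
            (Small-∣∣ (u₄ a d₁ (d₁ ⊝ d₂) d₃) s₄)
      in LeScaledRoot-4-1 {m = m} (≤-trans (Λ-δ⁵≤Σ∣u∣ a d₁ d₂ d₃) Σ∣u∣≤4m) small-m

    bad⇒big : ∀ a d₁ d₂ d₃ → let c = d₁ ⊝ d₂ in ¬ Good V δ ε (a , d₁ , d₂ , d₃) →
              ((¬ Small (u₁ a) ⊎ ¬ Small (u₂ a d₁)) ⊎ ¬ Small (u₃ a d₁ c)) ⊎ ¬ Small (u₄ a d₁ c d₃)
    bad⇒big a d₁ d₂ d₃ ¬good
      with Small? (u₁ a) | Small? (u₂ a d₁) | Small? (u₃ a d₁ (d₁ ⊝ d₂)) | Small? (u₄ a d₁ (d₁ ⊝ d₂) d₃)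
    ... | yes s₁ | yes s₂ | yes s₃ | yes s₄ = contradiction (small⇒good a d₁ d₂ d₃ s₁ s₂ s₃ s₄) ¬good
    ... | no ¬s₁ | _      | _      | _      = inj₁ (inj₁ (inj₁ ¬s₁))
    ... | yes _  | no ¬s₂ | _      | _      = inj₁ (inj₁ (inj₂ ¬s₂))
    ... | yes _  | yes _  | no ¬s₃ | _      = inj₁ (inj₂ ¬s₃)
    ... | yes _  | yes _  | yes _  | no ¬s₄ = inj₂ ¬s₄

    bad big₁ big₂ big₃ big₄ : G n × G n × G n × G n → ℚ
    bad q                   = ⟦ ¬? (Good? V δ ε q) ⟧
    big₁ (a , _  , _  , _ ) = ⟦ Big? (u₁ a) ⟧
    big₂ (a , d₁ , _  , _ ) = ⟦ Big? (u₂ a d₁) ⟧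
    big₃ (a , d₁ , d₂ , _ ) = ⟦ Big? (u₃ a d₁ (d₁ ⊝ d₂)) ⟧
    big₄ (a , d₁ , d₂ , d₃) = ⟦ Big? (u₄ a d₁ (d₁ ⊝ d₂) d₃) ⟧

    bad≤Σbig : ∀ q → bad q ≤ big₁ q + big₂ q + big₃ q + big₄ q
    bad≤Σbig q@(a , d₁ , d₂ , d₃) =
      ≤-trans (⟦⟧-union (bad⇒big a d₁ d₂ d₃) (¬? (Good? V δ ε q)) ((B₁ ⊎-dec B₂) ⊎-dec B₃) B₄)
        (+-monoˡ-≤ (big₄ q) (≤-trans (⟦⟧-union id ((B₁ ⊎-dec B₂) ⊎-dec B₃) (B₁ ⊎-dec B₂) B₃)
          (+-monoˡ-≤ (big₃ q) (⟦⟧-union id (B₁ ⊎-dec B₂) B₁ B₂))))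
      where
      B₁ = Big? (u₁ a)
      B₂ = Big? (u₂ a d₁)
      B₃ = Big? (u₃ a d₁ (d₁ ⊝ d₂))
      B₄ = Big? (u₄ a d₁ (d₁ ⊝ d₂) d₃)

    B : ℚ
    B = ∣G∣ * ∣G∣ * (∣G∣ * ∣G∣ * (∣G∣ * ∣G∣ * (∣G∣ * ∣G∣ * (ℕtoℚ 256 * (ε * ε * ε)))))

    T²≤B : ∀ {T} (K : G n → G n → G n → ℚ) → T ≡ Σ³ K →
           (∀ x y z → K x y z * K x y z ≤ ∣G∣ * ∣G∣ * (ℕtoℚ 256 * (ε * ε * ε))) → T * T ≤ B
    T²≤B K refl K²≤ = Σ³²≤|G|⁶*bound K²≤

    T₁²≤B : Σ quads big₁ * Σ quads big₁ ≤ B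
    T₁²≤B = T²≤B _ (trans (Σ-quads big₁) (Σ-sink₄ (λ a _ _ _ → ⟦ Big? (u₁ a) ⟧)))
      (λ _ _ _ → #Big²≤ (elems n) u₁ (Σ[corr²]≤∣G∣ε² (0≤𝟙≤1 V)))

    T₂²≤B : Σ quads big₂ * Σ quads big₂ ≤ B
    T₂²≤B = T²≤B _ (trans (Σ-quads big₂) (Σ-cong (elems n) (λ a → Σ-sink₃ (λ d₁ _ _ → ⟦ Big? (u₂ a d₁) ⟧))))
      (λ a _ _ → #Big²≤ (elems n) (u₂ a) (Σ[corr²]≤∣G∣ε² (0≤P₁≤1 a)))

    T₃²≤B : Σ quads big₃ * Σ quads big₃ ≤ B
    T₃²≤B = T²≤B _ (trans (Σ-quads big₃) (Σ-cong (elems n) (λ a → Σ-cong (elems n) (λ d₁ →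
        Σ-swap (elems n) (elems n) (λ d₂ _ → ⟦ Big? (u₃ a d₁ (d₁ ⊝ d₂)) ⟧)))))
      (λ a d₁ _ → #Big²≤ (elems n) (λ d₂ → u₃ a d₁ (d₁ ⊝ d₂))
        (subst (_≤ ∣G∣ * (ε * ε)) (sym (Σ-⊝ d₁ (λ c → u₃ a d₁ c * u₃ a d₁ c))) (Σ[corr²]≤∣G∣ε² (0≤P₂≤1 a d₁))))

    T₄²≤B : Σ quads big₄ * Σ quads big₄ ≤ B
    T₄²≤B = T²≤B _ (Σ-quads big₄)
      (λ a d₁ d₂ → #Big²≤ (elems n) (u₄ a d₁ (d₁ ⊝ d₂)) (Σ[corr²]≤∣G∣ε² (0≤P₃≤1 a d₁ (d₁ ⊝ d₂))))

    #bad≤ΣT : ℕtoℚ (#bad V δ ε) ≤ Σ quads big₁ + Σ quads big₂ + Σ quads big₃ + Σ quads big₄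
    #bad≤ΣT = begin
      ℕtoℚ (#bad V δ ε)                                       ≡⟨ length-filter≡Σ⟦⟧ (λ q → ¬? (Good? V δ ε q)) quads ⟩
      Σ quads bad                                             ≤⟨ Σ-mono quads bad≤Σbig ⟩
      Σ quads (λ q → big₁ q + big₂ q + big₃ q + big₄ q)       ≡⟨ Σ-+ quads _ big₄ ⟩
      Σ quads (λ q → big₁ q + big₂ q + big₃ q) + Σ quads big₄ ≡⟨ cong (_+ Σ quads big₄) (Σ-+ quads _ big₃) ⟩
      Σ quads (λ q → big₁ q + big₂ q) + Σ quads big₃ + Σ quads big₄
        ≡⟨ cong (λ t → t + Σ quads big₃ + Σ quads big₄) (Σ-+ quads big₁ big₂) ⟩
      Σ quads big₁ + Σ quads big₂ + Σ quads big₃ + Σ quads big₄ ∎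
      where open ≤-Reasoning

    #bad²≤∣G∣⁸ : ℕtoℚ (#bad V δ ε) * ℕtoℚ (#bad V δ ε) ≤ (∣G∣ ^ 4) * (∣G∣ ^ 4)
    #bad²≤∣G∣⁸ = subst (λ X → X * X ≤ (∣G∣ ^ 4) * (∣G∣ ^ 4))
      (sym (trans (length-filter≡Σ⟦⟧ (λ q → ¬? (Good? V δ ε q)) quads) (Σ-quads bad)))
      (≤-trans (Σ³²≤|G|⁶*bound (λ a d₁ d₂ → Σ²≤|xs|²*bound (λ d₃ → 0≤≤1⇒p*p≤1 (bad∈ (a , d₁ , d₂ , d₃)))))
        (≤-reflexive (solve 1 (λ N → N :* N :* (N :* N :* (N :* N :* (N :* N :* con 1ℚ)))
                                  := N :* (N :* (N :* (N :* con 1ℚ))) :* (N :* (N :* (N :* (N :* con 1ℚ))))) refl ∣G∣)))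
      where
      bad∈ : ∀ q → 0≤ bad q ≤1
      bad∈ q = ⟦⟧-nonNeg (¬? (Good? V δ ε q)) , ⟦⟧≤1 (¬? (Good? V δ ε q))

    #bad²≤4096∣G∣⁸ε³ : let X = ℕtoℚ (#bad V δ ε) in X * X ≤ ℕtoℚ 4096 * ((∣G∣ ^ 4) * (∣G∣ ^ 4) * (ε * ε * ε))
    #bad²≤4096∣G∣⁸ε³ =
      let m , m²≤B , ΣT≤4m = sum₄≤4*term (λ t → t * t ≤ B) (Σ quads big₁) (Σ quads big₂) (Σ quads big₃) (Σ quads big₄)
                                    T₁²≤B T₂²≤B T₃²≤B T₄²≤B
          X≤4m = ≤-trans #bad≤ΣT ΣT≤4m
          0≤X = 0≤ℕtoℚ (#bad V δ ε)
      in begin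
        X * X                          ≤⟨ *-mono-≤-nonNeg 0≤X (≤-trans 0≤X X≤4m) X≤4m X≤4m ⟩
        ℕtoℚ 4 * m * (ℕtoℚ 4 * m)      ≡⟨ solve 1 (λ m → con (ℕtoℚ 4) :* m :* (con (ℕtoℚ 4) :* m) := con (ℕtoℚ 16) :* (m :* m)) refl m ⟩
        ℕtoℚ 16 * (m * m)              ≤⟨ *-monoˡ-≤-nonNeg (ℕtoℚ 16) m²≤B ⟩
        ℕtoℚ 16 * B
          ≡⟨ solve 2 (λ N e → con (ℕtoℚ 16) :* (N :* N :* (N :* N :* (N :* N :* (N :* N :* (con (ℕtoℚ 256) :* (e :* e :* e))))))
                             := con (ℕtoℚ 4096) :* (N :* (N :* (N :* (N :* con 1ℚ))) :* (N :* (N :* (N :* (N :* con 1ℚ))))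
                                :* (e :* e :* e))) refl ∣G∣ ε ⟩
        ℕtoℚ 4096 * ((∣G∣ ^ 4) * (∣G∣ ^ 4) * (ε * ε * ε)) ∎
      where
      open ≤-Reasoning
      X = ℕtoℚ (#bad V δ ε)

claim3p5 : (p : ℕ) .{{_ : NonZero p}} → Prime p → (n : ℕ)
           → (c₀ δ ε : ℚ) (V : Field.G p n → Bool)
           → Gowers.ApproxQuadVariety p n c₀ δ ε V
           → LeScaledRoot 2 (ℕtoℚ 20 * (Gowers.∣G∣ p n ^ 4)) ε
               (ℕtoℚ (Gowers.#bad p n V δ ε))
claim3p5 p _ n c₀ δ ε V H =
  LeScaledRoot-2-20 {M = Gowers.∣G∣ p n ^ 4} (ApproxQuadVariety.ε≥0 H) (#bad²≤∣G∣⁸ H) (#bad²≤4096∣G∣⁸ε³ H)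
  where
  open Gowers p n using (module ApproxQuadVariety)
  open RootBounds using (LeScaledRoot-2-20)
  open Variety p n using (#bad²≤∣G∣⁸; #bad²≤4096∣G∣⁸ε³)
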